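{- Let $K$ be a finite field of characteristic $p$ and order $q$, and let $s$ be a positive integer with $\gcd(s,q-1)=1$. The permutation $\tau$ of $\mathcal{W}_{K,s}$ is a single cycle (i.e. a cycle containing all elements of $\mathcal{W}_{K,s}$) if and only if $K=\mathbb{F}_2$; in that case $s$ is degenerate and $\tau$ is a $1$-cycle.
   Context: Let $\zeta=\exp(2\pi i/p)$, $\psi(x)=\zeta^{\mathrm{Tr}(x)}$ with $\mathrm{Tr}\colon K\to\mathbb{F}_p$ the absolute trace, $W_u=\sum_{x\in K}\psi(x^s-ux)$, and $\mathcal{W}_{K,s}=\{W_u: u\in K^\times\}$. Let $\gamma$ be a generator of $\mathbb{F}_p^\times$ and $\sigma\in\mathrm{Gal}(\mathbb{Q}(\zeta)/\mathbb{Q})$ with $\sigma(\zeta)=\zeta^\gamma$; it is known that $\sigma(W_u)=W_{\gamma^{1-1/s}u}$, so $\sigma$ maps $\mathcal{W}_{K,s}$ to itself, and $\tau$ denotes the resulting permutation of $\mathcal{W}_{K,s}$. The exponent $s$ is degenerate over $K$ if $s\equiv p^k\pmod{q-1}$ for some integer $k$. -}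

module Defs where

open import Level using (0ℓ)
open import Algebra.Bundles using (CommutativeRing)
open import Data.Nat as ℕ using (ℕ; zero; suc; _≤_; _<_; _%_; _∸_)
open import Data.Integer as ℤ using (ℤ; +_)
open import Data.Fin using (Fin; toℕ)
open import Data.Fin.Base using (fromℕ<)
open import Data.List using (List; length; filter; foldr; map; allFin)
open import Data.Product using (Σ; ∃; _×_; _,_)
open import Relation.Nullary using (¬_; Dec; yes; no)
open import Relation.Unary using (Pred)
open import Relation.Binary using (Decidable)
open import Relation.Binary.PropositionalEquality using (_≡_)

-- A finite field: a commutative ring (with setoid equality _≈_, decidable),
-- 1 ≠ 0, every nonzero element invertible, and an explicit enumeration
-- Fin q ≅ Carrier (injective and surjective up to ≈); q is the order.
record FiniteField : Set₁ where
  field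
    commRing : CommutativeRing 0ℓ 0ℓ
  open CommutativeRing commRing public
  field
    _≈?_      : Decidable _≈_
    1≉0       : ¬ (1# ≈ 0#)
    inverse   : ∀ x → ¬ (x ≈ 0#) → ∃ λ y → x * y ≈ 1#
    q         : ℕ
    enum      : Fin q → Carrier
    enum-inj  : ∀ i j → enum i ≈ enum j → i ≡ j
    enum-surj : ∀ x → ∃ λ i → enum i ≈ x

module _ (K : FiniteField) where
  open FiniteField K

  pow : Carrier → ℕ → Carrier
  pow x zero    = 1#
  pow x (suc n) = x * pow x n

  nat : ℕ → Carrier
  nat zero    = 0#
  nat (suc n) = 1# + nat n

  -- absolute trace K → prime field, for q = p ^ n :  Tr x = Σ_{i<n} x^(p^i)
  Tr : (p n : ℕ) → Carrier → Carrier
  Tr p zero    x = 0#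
  Tr p (suc i) x = pow x (p ℕ.^ i) + Tr p i x

  -- The Weil sum W_u = Σ_{x∈K} ζ^{Tr(x^s - u x)} as an element of ℤ[ζ_p],
  -- given by its coefficient vector: coefficient of ζ^j is
  -- #{x ∈ K : Tr(x^s - u x) = j·1}.
  W : (p n s : ℕ) → Carrier → Fin p → ℕ
  W p n s u j = length (filter (λ i → nat (toℕ j) ≈? Tr p n (pow (enum i) s - u * enum i)) (allFin q))

-- reduction modulo m (with the harmless convention a mod 0 = a)
modp : ℕ → ℕ → ℕ
modp zero    a = a
modp (suc m) a = a % suc m

-- Elements of ℤ[ζ_p] ≅ ℤ[x]/(1 + x + ... + x^{p-1}) represented by coefficient
-- vectors (coefficient of ζ^j for j < p); two vectors represent the same
-- cyclotomic integer iff they differ by a constant multiple of (1,...,1).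
CycEq : (p : ℕ) → (Fin p → ℕ) → (Fin p → ℕ) → Set
CycEq p N M = ∃ λ (c : ℤ) → ∀ j → + N j ≡ (+ M j) ℤ.+ c

sumFin : (p : ℕ) → (Fin p → ℕ) → ℕ
sumFin p f = foldr ℕ._+_ 0 (map f (allFin p))

-- σ^k applied to Σ_j N_j ζ^j, where σ(ζ) = ζ^γ:  Σ_j N_j ζ^{γ^k j}.
-- Coefficient of ζ^i is Σ_{j : γ^k j ≡ i (mod p)} N_j.
σpow : (p γ k : ℕ) → (Fin p → ℕ) → Fin p → ℕ
σpow p γ k N i = sumFin p (λ j → coeff j (modp p (γ ℕ.^ k ℕ.* toℕ j) ℕ.≟ toℕ i))
  where
  coeff : (j : Fin p) → Dec (modp p (γ ℕ.^ k ℕ.* toℕ j) ≡ toℕ i) → ℕ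
  coeff j (yes _) = N j
  coeff j (no _)  = 0

module _ (K : FiniteField) (p n s γ : ℕ) where
  open FiniteField K

  Units : Set
  Units = Σ Carrier (λ u → ¬ (u ≈ 0#))

  Wu : Units → Fin p → ℕ
  Wu (u , _) = W K p n s u

  -- τ (the permutation of the set 𝒲_{K,s} of values W_u induced by σ) is a
  -- single cycle: some value w ∈ 𝒲 has τ-orbit {σ^k(w)} equal to all of 𝒲.
  SingleCycle : Set
  SingleCycle = ∃ λ (u₀ : Units) → ∀ (u : Units) → ∃ λ (k : ℕ) →
                  CycEq p (σpow p γ k (Wu u₀)) (Wu u)

  -- τ is a 1-cycle: 𝒲 has exactly one element, fixed by σ.
  OneCycle : Set
  OneCycle = (∀ (u v : Units) → CycEq p (Wu u) (Wu v))
           × (∀ (u : Units) → CycEq p (σpow p γ 1 (Wu u)) (Wu u))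

IsGenerator : (p γ : ℕ) → Set
IsGenerator p γ = 1 ≤ γ × γ < p × (∀ j → 1 ≤ j → j < p → ∃ λ k → modp p (γ ℕ.^ k) ≡ j)

Degenerate : (p q s : ℕ) → Set
Degenerate p q s = ∃ λ k → modp (q ∸ 1) s ≡ modp (q ∸ 1) (p ℕ.^ k)

{-# OPTIONS --safe #-}
module Submission where

-- Write W₀(u) for the coefficient of ζ⁰ in W_u, i.e. the number of x with Tr(x^s − ux) = 0, and T for the
-- number of x with Tr x = 0.  σ fixes the coefficient of ζ⁰ and every W_u has coefficient sum q, so if τ is a
-- single cycle then W₀ takes one value C on K^×.  Counting pairs (u, x) gives Σ_u W₀(u) = q + (q − 1)T, and
-- W₀(0) = T because x ↦ x^s permutes K; hence (q − 1)C + T = q + (q − 1)T.  For q ≥ 3 this forces T = q or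
-- (T = 1, C = 2).  The trace is not identically zero, and T = 1 makes Tr an injection into 𝔽_p, so q = p is
-- odd, s is odd, and x^s = x has the three solutions 0, ±1, contradicting C = 2.  When q = 2 every unit is 1
-- and σ is trivial.

open import Defs
open import Level using (0ℓ)
open import Algebra.Bundles using (CommutativeMonoid; CommutativeRing)
open import Data.Nat as ℕ using (ℕ; zero; suc; _≤_; _<_; s≤s; z≤n; _^_; _∸_)
import Data.Nat.Properties as ℕP
import Data.Integer as ℤ
open import Data.Nat.Primality using (Prime; prime⇒nonTrivial)
open import Data.Nat.Coprimality using (Coprime)
open import Data.Nat.Divisibility using (divides; ∣⇒≤)
open import Data.Fin as Fin using (Fin; zero; suc; toℕ)
import Data.Fin.Properties as FinP
open import Data.List using (List; []; _∷_; length; filter; tabulate; map; foldr)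
open import Data.Product using (∃; _×_; _,_; proj₁; proj₂)
open import Data.Sum using (_⊎_; inj₁; inj₂; [_,_]′)
open import Data.Empty using (⊥; ⊥-elim)
open import Function using (_∘_; id; case_of_)
open import Function.Bundles using (_⇔_; mk⇔)
import Algebra.Properties.CommutativeMonoid.Sum as MSum
open import Relation.Nullary using (¬_; Dec; yes; no)
open import Relation.Nullary.Decidable using (decidable-stable)
open import Relation.Unary using (Pred)
open import Relation.Binary.PropositionalEquality as ≡ using (_≡_; _≢_)
import Relation.Binary.Reasoning.Setoid

module CommutativeMonoidSum (M : CommutativeMonoid 0ℓ 0ℓ) where

  open CommutativeMonoid M
  open import Algebra.Properties.CommutativeMonoid.Sum M using (sum; sum-cong-≋; sum-replicate; sum-replicate-zero)
  open import Algebra.Properties.Monoid.Mult monoid using () renaming (_×_ to _×ᴹ_)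
  open import Relation.Binary.Reasoning.Setoid setoid

  sum-supported-at : ∀ {n} (f : Fin n → Carrier) i → (∀ j → j ≢ i → f j ≈ ε) → sum f ≈ f i
  sum-supported-at {suc n} f zero f≈ε =
    trans (∙-congˡ (trans (sum-cong-≋ (λ j → f≈ε (suc j) λ ())) (sum-replicate-zero n))) (identityʳ _)
  sum-supported-at {suc n} f (suc i) f≈ε =
    trans (∙-cong (f≈ε zero λ ()) (sum-supported-at (f ∘ suc) i (λ j j≢i → f≈ε (suc j) (j≢i ∘ FinP.suc-injective))))
          (identityˡ _)

  sum-constant-except : ∀ {n} (g : Fin n → Carrier) i a b → g i ≈ a → (∀ j → j ≢ i → g j ≈ b) →
                        sum g ∙ b ≈ a ∙ (n ×ᴹ b)
  sum-constant-except {suc n} g zero a b gi h = begin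
      (g zero ∙ sum (g ∘ suc)) ∙ b  ≈⟨ ∙-congʳ (∙-cong gi (trans (sum-cong-≋ (λ j → h (suc j) λ ())) (sum-replicate n))) ⟩
      (a ∙ (n ×ᴹ b)) ∙ b             ≈⟨ assoc a (n ×ᴹ b) b ⟩
      a ∙ ((n ×ᴹ b) ∙ b)             ≈⟨ ∙-congˡ (comm (n ×ᴹ b) b) ⟩
      a ∙ (suc n ×ᴹ b)               ∎
  sum-constant-except {suc n} g (suc i) a b gi h = begin
      (g zero ∙ sum (g ∘ suc)) ∙ b  ≈⟨ assoc (g zero) _ b ⟩
      g zero ∙ (sum (g ∘ suc) ∙ b)  ≈⟨ ∙-cong (h zero λ ())
                                         (sum-constant-except (g ∘ suc) i a b gi (λ j j≢i → h (suc j) (j≢i ∘ FinP.suc-injective))) ⟩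
      b ∙ (a ∙ (n ×ᴹ b))             ≈⟨ comm b _ ⟩
      (a ∙ (n ×ᴹ b)) ∙ b             ≈⟨ assoc a (n ×ᴹ b) b ⟩
      a ∙ ((n ×ᴹ b) ∙ b)             ≈⟨ ∙-congˡ (comm (n ×ᴹ b) b) ⟩
      a ∙ (suc n ×ᴹ b)               ∎

module FinSum where

  open import Data.Nat using (_+_; _*_)
  open import Algebra.Properties.CommutativeMonoid.Sum ℕP.+-0-commutativeMonoid public
    using (sum; sum-cong-≗; ∑-distrib-+; ∑-comm)
  open import Algebra.Properties.Monoid.Mult ℕP.+-0-monoid using () renaming (_×_ to _×ᴺ_)

  χ : ∀ {P : Set} → Dec P → ℕ
  χ (yes _) = 1
  χ (no _)  = 0

  χ≤1 : ∀ {P : Set} (d : Dec P) → χ d ≤ 1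
  χ≤1 (yes _) = ℕP.≤-refl
  χ≤1 (no _)  = z≤n

  χ-yes : ∀ {P : Set} (d : Dec P) → P → χ d ≡ 1
  χ-yes (yes _) _  = ≡.refl
  χ-yes (no ¬p) p = ⊥-elim (¬p p)

  χ-no : ∀ {P : Set} (d : Dec P) → ¬ P → χ d ≡ 0
  χ-no (yes p) ¬p = ⊥-elim (¬p p)
  χ-no (no _)  _  = ≡.refl

  χ≡1⇒ : ∀ {P : Set} (d : Dec P) → χ d ≡ 1 → P
  χ≡1⇒ (yes p) _ = p

  χ-cong : ∀ {P Q : Set} (d : Dec P) (e : Dec Q) → (P → Q) → (Q → P) → χ d ≡ χ e
  χ-cong (yes _)  (yes _)  _ _ = ≡.refl
  χ-cong (yes p)  (no ¬q) f _ = ⊥-elim (¬q (f p))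
  χ-cong (no ¬p) (yes q)  _ g = ⊥-elim (¬p (g q))
  χ-cong (no _)   (no _)   _ _ = ≡.refl

  length-filter-tabulate : ∀ {A : Set} {P : Pred A 0ℓ} (P? : ∀ x → Dec (P x)) {n} (g : Fin n → A) →
                           length (filter P? (tabulate g)) ≡ sum (λ i → χ (P? (g i)))
  length-filter-tabulate P? {zero}  g = ≡.refl
  length-filter-tabulate P? {suc n} g with P? (g zero)
  ... | yes _ = ≡.cong suc (length-filter-tabulate P? (g ∘ suc))
  ... | no _  = length-filter-tabulate P? (g ∘ suc)

  foldr-map-tabulate : ∀ {A : Set} {n} (f : A → ℕ) (g : Fin n → A) → foldr _+_ 0 (map f (tabulate g)) ≡ sum (f ∘ g)
  foldr-map-tabulate {n = zero}  f g = ≡.refl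
  foldr-map-tabulate {n = suc n} f g = ≡.cong (f (g zero) +_) (foldr-map-tabulate f (g ∘ suc))

  sum-const : ∀ n c → sum {n} (λ _ → c) ≡ n * c
  sum-const zero    c = ≡.refl
  sum-const (suc n) c = ≡.cong (c +_) (sum-const n c)

  sum-ones : ∀ n → sum {n} (λ _ → 1) ≡ n
  sum-ones n = ≡.trans (sum-const n 1) (ℕP.*-identityʳ n)

  sum-mono : ∀ {n} {f g : Fin n → ℕ} → (∀ i → f i ≤ g i) → sum f ≤ sum g
  sum-mono {zero}  _ = z≤n
  sum-mono {suc n} h = ℕP.+-mono-≤ (h zero) (sum-mono (h ∘ suc))

  sum-supported-at : ∀ {n} (f : Fin n → ℕ) i → (∀ j → j ≢ i → f j ≡ 0) → sum f ≡ f i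
  sum-supported-at = CommutativeMonoidSum.sum-supported-at ℕP.+-0-commutativeMonoid

  indicator : ∀ {n} → Fin n → Fin n → ℕ
  indicator i j = χ (j Fin.≟ i)

  sum-indicator : ∀ {n} (i : Fin n) → sum (indicator i) ≡ 1
  sum-indicator i = ≡.trans (sum-supported-at (indicator i) i (λ j → χ-no (j Fin.≟ i))) (χ-yes (i Fin.≟ i) ≡.refl)

  sum-constant-except : ∀ {n} (g : Fin n → ℕ) i a b → g i ≡ a → (∀ j → j ≢ i → g j ≡ b) →
                        sum g + b ≡ a + n * b
  sum-constant-except {n} g i a b gi h =
    ≡.trans (CommutativeMonoidSum.sum-constant-except ℕP.+-0-commutativeMonoid g i a b gi h)
            (≡.cong (a +_) (×≡* n))
    where
    ×≡* : ∀ n → n ×ᴺ b ≡ n * b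
    ×≡* zero    = ≡.refl
    ×≡* (suc n) = ≡.cong (b +_) (×≡* n)

  ≤-sum : ∀ {n} (f : Fin n → ℕ) i → f i ≤ sum f
  ≤-sum f i = ≡.subst (_≤ sum f) sum-g (sum-mono g≤f)
    where
    g : Fin _ → ℕ
    g j = indicator i j * f i
    sum-g : sum g ≡ f i
    sum-g = ≡.trans (sum-supported-at g i (λ j → ≡.cong (_* f i) ∘ χ-no (j Fin.≟ i)))
                    (≡.trans (≡.cong (_* f i) (χ-yes (i Fin.≟ i) ≡.refl)) (ℕP.*-identityˡ _))
    g≤f : ∀ j → g j ≤ f j
    g≤f j with j Fin.≟ i
    ... | yes ≡.refl = ℕP.≤-reflexive (ℕP.+-identityʳ _)
    ... | no _       = z≤n

  2≤sum : ∀ {n} (f : Fin n → ℕ) i j → i ≢ j → f i ≡ 1 → f j ≡ 1 → 2 ≤ sum f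
  2≤sum f i j i≢j fi fj = ≡.subst (_≤ sum f) sum-ij (sum-mono ij≤f)
    where
    sum-ij : sum (λ k → indicator i k + indicator j k) ≡ 2
    sum-ij = ≡.trans (∑-distrib-+ (indicator i) (indicator j)) (≡.cong₂ _+_ (sum-indicator i) (sum-indicator j))
    ij≤f : ∀ k → indicator i k + indicator j k ≤ f k
    ij≤f k with k Fin.≟ i | k Fin.≟ j
    ... | yes ≡.refl | yes ≡.refl = ⊥-elim (i≢j ≡.refl)
    ... | yes ≡.refl | no _       = ℕP.≤-reflexive (≡.sym fi)
    ... | no _       | yes ≡.refl = ℕP.≤-reflexive (≡.sym fj)
    ... | no _       | no _       = z≤n

  3≤sum : ∀ {n} (f : Fin n → ℕ) i j k → i ≢ j → i ≢ k → j ≢ k → f i ≡ 1 → f j ≡ 1 → f k ≡ 1 → 3 ≤ sum f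
  3≤sum f i j k i≢j i≢k j≢k fi fj fk = ≡.subst (_≤ sum f) sum-ijk (sum-mono ijk≤f)
    where
    ind-ijk : Fin _ → ℕ
    ind-ijk l = (indicator i l + indicator j l) + indicator k l
    sum-ijk : sum ind-ijk ≡ 3
    sum-ijk = ≡.trans (∑-distrib-+ (λ l → indicator i l + indicator j l) (indicator k))
              (≡.cong₂ _+_ (≡.trans (∑-distrib-+ (indicator i) (indicator j))
                                     (≡.cong₂ _+_ (sum-indicator i) (sum-indicator j)))
                           (sum-indicator k))
    ijk≤f : ∀ l → ind-ijk l ≤ f l
    ijk≤f l with l Fin.≟ i | l Fin.≟ j | l Fin.≟ k
    ... | yes ≡.refl | yes ≡.refl | _          = ⊥-elim (i≢j ≡.refl)
    ... | yes ≡.refl | no _       | yes ≡.refl = ⊥-elim (i≢k ≡.refl)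
    ... | no _       | yes ≡.refl | yes ≡.refl = ⊥-elim (j≢k ≡.refl)
    ... | yes ≡.refl | no _       | no _       = ℕP.≤-reflexive (≡.sym fi)
    ... | no _       | yes ≡.refl | no _       = ℕP.≤-reflexive (≡.sym fj)
    ... | no _       | no _       | yes ≡.refl = ℕP.≤-reflexive (≡.sym fk)
    ... | no _       | no _       | no _       = z≤n

  sum≡n⇒≡1 : ∀ {n} (f : Fin n → ℕ) → (∀ i → f i ≤ 1) → sum f ≡ n → ∀ i → f i ≡ 1
  sum≡n⇒≡1 {suc n} f f≤1 sum≡ = go
    where
    rest≤n : sum (f ∘ suc) ≤ n
    rest≤n = ℕP.≤-trans (sum-mono (f≤1 ∘ suc)) (ℕP.≤-reflexive (sum-ones n))
    f0≡1 : f zero ≡ 1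
    f0≡1 = ℕP.≤-antisym (f≤1 zero)
             (ℕP.+-cancelʳ-≤ n 1 (f zero) (ℕP.≤-trans (ℕP.≤-reflexive (≡.sym sum≡)) (ℕP.+-monoʳ-≤ (f zero) rest≤n)))
    go : ∀ i → f i ≡ 1
    go zero    = f0≡1
    go (suc i) = sum≡n⇒≡1 (f ∘ suc) (f≤1 ∘ suc) (ℕP.+-cancelˡ-≡ 1 _ _ (≡.trans (≡.cong (_+ sum (f ∘ suc)) (≡.sym f0≡1)) sum≡)) i

module Arithmetic where

  open import Data.Nat using (_+_; _*_)
  open import Data.Nat.Solver using (module +-*-Solver)
  open import Data.Nat using (_%_; _/_)
  open import Data.Nat.Divisibility using (_∣_; ∣-refl; _∣0; m%n≡0⇒n∣m)
  open import Data.Nat.DivMod using (m%n<n; m≡m%n+[m/n]*n)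
  open import Data.Nat.Coprimality using (coprime-Bézout)
  open import Data.Nat.GCD using (module Bézout)
  open +-*-Solver using (solve; _:=_; _:+_; _:*_; con)

  coprime⇒inverse-mod : ∀ s Q → 1 ≤ s → Coprime s Q → ∃ λ a → ∃ λ m → s * a ≡ 1 + m * Q
  coprime⇒inverse-mod s zero          _   s⊥0 = 1 , 0 , ≡.trans (ℕP.*-identityʳ s) (s⊥0 (∣-refl , s ∣0))
  coprime⇒inverse-mod s (suc zero)    1≤s _   = 1 , s ∸ 1 , ≡.trans (ℕP.*-identityʳ s)
    (≡.trans (≡.sym (ℕP.m+[n∸m]≡n 1≤s)) (≡.cong (1 +_) (≡.sym (ℕP.*-identityʳ (s ∸ 1)))))
  coprime⇒inverse-mod s (suc (suc r)) _   s⊥Q with coprime-Bézout s⊥Q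
  ... | Bézout.+- a b 1+bQ≡as = a , b , ≡.trans (ℕP.*-comm s a) (≡.sym 1+bQ≡as)
  ... | Bézout.-+ a zero    ()
  ... | Bézout.-+ a (suc b) 1+as≡bQ = a * suc r , b * suc r + r , ℕP.+-cancelˡ-≡ (suc r) _ _ (begin
      suc r + s * (a * suc r)
        ≡⟨ solve 3 (λ a s r → (con 1 :+ r) :+ s :* (a :* (con 1 :+ r)) := (con 1 :+ a :* s) :* (con 1 :+ r)) ≡.refl a s r ⟩
      (1 + a * s) * suc r
        ≡⟨ ≡.cong (_* suc r) 1+as≡bQ ⟩
      (suc b * suc (suc r)) * suc r
        ≡⟨ solve 2 (λ b r → ((con 1 :+ b) :* (con 2 :+ r)) :* (con 1 :+ r)
                            := (con 1 :+ r) :+ (con 1 :+ (b :* (con 1 :+ r) :+ r) :* (con 2 :+ r))) ≡.refl b r ⟩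
      suc r + (1 + (b * suc r + r) * suc (suc r))
        ∎)
    where open ≡.≡-Reasoning

  ¬2∣⇒odd : ∀ m → ¬ (2 ∣ m) → m ≡ 1 + (m / 2) * 2
  ¬2∣⇒odd m 2∤m with m % 2 in m%2≡r | m%n<n m 2
  ... | 0           | _ = ⊥-elim (2∤m (m%n≡0⇒n∣m m 2 m%2≡r))
  ... | 1           | _ = ≡.trans (m≡m%n+[m/n]*n m 2) (≡.cong (_+ (m / 2) * 2) m%2≡r)
  ... | suc (suc _) | s≤s (s≤s ())

  eliminate-total : ∀ Q C T X → X + C ≡ T + suc Q * C → X + T ≡ suc Q + suc Q * T → Q * C + T ≡ suc Q + Q * T
  eliminate-total Q C T X e₁ e₂ = ℕP.+-cancelˡ-≡ (C + T) _ _ (begin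
      (C + T) + (Q * C + T)        ≡⟨ solve 3 (λ C T Q → (C :+ T) :+ (Q :* C :+ T) := (T :+ (con 1 :+ Q) :* C) :+ T) ≡.refl C T Q ⟩
      (T + suc Q * C) + T          ≡⟨ ≡.cong (_+ T) (≡.sym e₁) ⟩
      (X + C) + T                  ≡⟨ solve 3 (λ X C T → (X :+ C) :+ T := (X :+ T) :+ C) ≡.refl X C T ⟩
      (X + T) + C                  ≡⟨ ≡.cong (_+ C) e₂ ⟩
      (suc Q + suc Q * T) + C      ≡⟨ solve 3 (λ Q T C → ((con 1 :+ Q) :+ (con 1 :+ Q) :* T) :+ C := (C :+ T) :+ ((con 1 :+ Q) :+ Q :* T)) ≡.refl Q T C ⟩
      (C + T) + (suc Q + Q * T)    ∎)
    where open ≡.≡-Reasoning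

  -- Q·C + T = (Q + 1) + Q·T forces T ≡ 1 (mod Q); the bounds on T leave two solutions.
  count-equation-solutions : ∀ Q C T → 1 ≤ Q → 1 ≤ T → T ≤ suc Q → Q * C + T ≡ suc Q + Q * T →
                             T ≡ suc Q ⊎ (T ≡ 1 × C ≡ 2)
  count-equation-solutions Q C T 1≤Q 1≤T T≤q eq with C ℕ.≤? T
  ... | yes C≤T = inj₁ (ℕP.≤-antisym T≤q (ℕP.+-cancelʳ-≤ (Q * T) (suc Q) T (begin
      suc Q + Q * T  ≡⟨ ≡.sym eq ⟩
      Q * C + T      ≤⟨ ℕP.+-monoˡ-≤ T (ℕP.*-monoʳ-≤ Q C≤T) ⟩
      Q * T + T      ≡⟨ ℕP.+-comm (Q * T) T ⟩
      T + Q * T      ∎)))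
    where open ℕP.≤-Reasoning
  ... | no C≰T = inj₂ (T≡1 , ℕP.*-cancelˡ-≡ C 2 Q {{ℕ.>-nonZero 1≤Q}} (ℕP.+-cancelʳ-≡ 1 (Q * C) (Q * 2) (begin-equality
      Q * C + 1      ≡⟨ ≡.cong (Q * C +_) (≡.sym T≡1) ⟩
      Q * C + T      ≡⟨ eq ⟩
      suc Q + Q * T  ≡⟨ ≡.cong (λ t → suc Q + Q * t) T≡1 ⟩
      suc Q + Q * 1  ≡⟨ solve 1 (λ Q → (con 1 :+ Q) :+ Q :* con 1 := Q :* con 2 :+ con 1) ≡.refl Q ⟩
      Q * 2 + 1      ∎)))
    where
    open ℕP.≤-Reasoning
    T≤1 : T ≤ 1
    T≤1 = ℕP.+-cancelˡ-≤ (Q + Q * T) T 1 (begin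
      (Q + Q * T) + T  ≡⟨ ≡.cong (_+ T) (≡.sym (ℕP.*-suc Q T)) ⟩
      Q * suc T + T    ≤⟨ ℕP.+-monoˡ-≤ T (ℕP.*-monoʳ-≤ Q (ℕP.≰⇒> C≰T)) ⟩
      Q * C + T        ≡⟨ eq ⟩
      suc Q + Q * T    ≡⟨ solve 2 (λ Q T → (con 1 :+ Q) :+ Q :* T := (Q :+ Q :* T) :+ con 1) ≡.refl Q T ⟩
      (Q + Q * T) + 1  ∎)
    T≡1 : T ≡ 1
    T≡1 = ℕP.≤-antisym T≤1 1≤T

-- Solving with the ring's own
-- elements as coefficients (Algebra.Solver.Ring.Simple) would test them with _≈?_, which does not compute.
module IntegerCoefficientSolver (R : CommutativeRing 0ℓ 0ℓ) where

  open import Algebra.Solver.Ring.AlmostCommutativeRing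
  open import Data.Integer using (ℤ; +_; -[1+_]; _⊖_; sign; ∣_∣; _◃_)
  import Data.Integer.Properties as ℤP
  import Data.Sign as Sign
  open import Data.Maybe using (Maybe; just; nothing)

  open CommutativeRing R
  open import Relation.Binary.Reasoning.Setoid setoid
  open import Algebra.Properties.Ring ring using (-‿distribˡ-*; -‿distribʳ-*; -‿involutive; -0#≈0#; -‿+-comm)
  open import Algebra.Properties.Monoid.Mult +-monoid using (×-homo-+) renaming (_×_ to _×ᴿ_)
  open import Algebra.Properties.Semiring.Mult semiring using (×1-homo-*)

  signed : Sign.Sign → Carrier → Carrier
  signed Sign.+ x = x
  signed Sign.- x = - x

  signed-cong : ∀ s {x y} → x ≈ y → signed s x ≈ signed s y
  signed-cong Sign.+ = id
  signed-cong Sign.- = -‿cong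

  signed-* : ∀ s t x y → signed (s Sign.* t) (x * y) ≈ signed s x * signed t y
  signed-* Sign.+ Sign.+ x y = refl
  signed-* Sign.+ Sign.- x y = -‿distribʳ-* x y
  signed-* Sign.- Sign.+ x y = -‿distribˡ-* x y
  signed-* Sign.- Sign.- x y = begin
      x * y          ≈⟨ sym (-‿involutive _) ⟩
      - - (x * y)    ≈⟨ -‿cong (-‿distribʳ-* x y) ⟩
      - (x * - y)    ≈⟨ -‿distribˡ-* x (- y) ⟩
      (- x) * (- y)  ∎

  ⟦_⟧ℤ : ℤ → Carrier
  ⟦ z ⟧ℤ = signed (sign z) (∣ z ∣ ×ᴿ 1#)

  ⟦◃⟧ : ∀ s n → ⟦ s ◃ n ⟧ℤ ≈ signed s (n ×ᴿ 1#)
  ⟦◃⟧ Sign.+ zero    = refl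
  ⟦◃⟧ Sign.- zero    = sym -0#≈0#
  ⟦◃⟧ Sign.+ (suc n) = refl
  ⟦◃⟧ Sign.- (suc n) = refl

  *-homo : ∀ i j → ⟦ i ℤ.* j ⟧ℤ ≈ ⟦ i ⟧ℤ * ⟦ j ⟧ℤ
  *-homo i j = begin
      ⟦ s ◃ ∣ i ∣ ℕ.* ∣ j ∣ ⟧ℤ                 ≈⟨ ⟦◃⟧ s (∣ i ∣ ℕ.* ∣ j ∣) ⟩
      signed s ((∣ i ∣ ℕ.* ∣ j ∣) ×ᴿ 1#)         ≈⟨ signed-cong s (×1-homo-* ∣ i ∣ ∣ j ∣) ⟩
      signed s ((∣ i ∣ ×ᴿ 1#) * (∣ j ∣ ×ᴿ 1#))    ≈⟨ signed-* (sign i) (sign j) _ _ ⟩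
      ⟦ i ⟧ℤ * ⟦ j ⟧ℤ                           ∎
    where
    s : Sign.Sign
    s = sign i Sign.* sign j

  ⟦⊖⟧ : ∀ m n → ⟦ m ⊖ n ⟧ℤ ≈ m ×ᴿ 1# - n ×ᴿ 1#
  ⟦⊖⟧ m       zero    = sym (trans (+-congˡ -0#≈0#) (+-identityʳ _))
  ⟦⊖⟧ zero    (suc n) = sym (+-identityˡ _)
  ⟦⊖⟧ (suc m) (suc n) = begin
      ⟦ suc m ⊖ suc n ⟧ℤ                       ≡⟨ ≡.cong ⟦_⟧ℤ (ℤP.[1+m]⊖[1+n]≡m⊖n m n) ⟩
      ⟦ m ⊖ n ⟧ℤ                               ≈⟨ ⟦⊖⟧ m n ⟩
      M - N                                    ≈⟨ sym (+-identityˡ _) ⟩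
      0# + (M - N)                             ≈⟨ +-congʳ (sym (-‿inverseʳ 1#)) ⟩
      (1# - 1#) + (M - N)                      ≈⟨ +-assoc 1# (- 1#) _ ⟩
      1# + (- 1# + (M - N))                    ≈⟨ +-congˡ (sym (+-assoc (- 1#) M _)) ⟩
      1# + ((- 1# + M) - N)                    ≈⟨ +-congˡ (+-congʳ (+-comm (- 1#) M)) ⟩
      1# + ((M - 1#) - N)                      ≈⟨ +-congˡ (+-assoc M (- 1#) _) ⟩
      1# + (M + (- 1# - N))                    ≈⟨ sym (+-assoc 1# M _) ⟩
      (1# + M) + (- 1# - N)                    ≈⟨ +-congˡ (-‿+-comm 1# N) ⟩
      (1# + M) - (1# + N)                      ∎
    where
    M N : Carrier
    M = m ×ᴿ 1#
    N = n ×ᴿ 1#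

  +-homo : ∀ i j → ⟦ i ℤ.+ j ⟧ℤ ≈ ⟦ i ⟧ℤ + ⟦ j ⟧ℤ
  +-homo (+ m)    (+ n)    = ×-homo-+ 1# m n
  +-homo (+ m)    -[1+ n ] = ⟦⊖⟧ m (suc n)
  +-homo -[1+ m ] (+ n)    = trans (⟦⊖⟧ n (suc m)) (+-comm _ _)
  +-homo -[1+ m ] -[1+ n ] = begin
      - (suc (suc m ℕ.+ n) ×ᴿ 1#)               ≡⟨ ≡.cong (λ k → - (suc k ×ᴿ 1#)) (≡.sym (ℕP.+-suc m n)) ⟩
      - ((suc m ℕ.+ suc n) ×ᴿ 1#)               ≈⟨ -‿cong (×-homo-+ 1# (suc m) (suc n)) ⟩
      - (suc m ×ᴿ 1# + suc n ×ᴿ 1#)              ≈⟨ sym (-‿+-comm _ _) ⟩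
      - (suc m ×ᴿ 1#) + - (suc n ×ᴿ 1#)          ∎

  -‿homo : ∀ i → ⟦ ℤ.- i ⟧ℤ ≈ - ⟦ i ⟧ℤ
  -‿homo (+ zero)  = sym -0#≈0#
  -‿homo (+ suc n) = refl
  -‿homo -[1+ n ]  = sym (-‿involutive _)

  homomorphism : CommutativeRing.rawRing ℤP.+-*-commutativeRing -Raw-AlmostCommutative⟶ fromCommutativeRing R
  homomorphism = record
    { ⟦_⟧    = ⟦_⟧ℤ
    ; +-homo = +-homo
    ; *-homo = *-homo
    ; -‿homo = -‿homo
    ; 0-homo = refl
    ; 1-homo = +-identityʳ 1#
    }

  equal? : ∀ a b → Maybe (⟦ a ⟧ℤ ≈ ⟦ b ⟧ℤ)
  equal? a b with a ℤ.≟ b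
  ... | yes ≡.refl = just refl
  ... | no _       = nothing

  open import Algebra.Solver.Ring (CommutativeRing.rawRing ℤP.+-*-commutativeRing) (fromCommutativeRing R) homomorphism equal? public

module FieldProperties (K : FiniteField) where

  open FiniteField K public hiding (zero)
  open import Algebra.Properties.Semiring.Exp semiring public using () renaming (_^_ to _^ᴿ_)
  module ≈-Reasoning = Relation.Binary.Reasoning.Setoid setoid
  open ≈-Reasoning
  open import Algebra.Properties.Ring ring using (-‿involutive)
  open import Algebra.Properties.Ring ring public using (-0#≈0#)
  open import Algebra.Properties.Monoid.Mult +-monoid using (×-homo-+) renaming (_×_ to _×ᴿ_)
  open import Algebra.Properties.Semiring.Mult semiring using (×1-homo-*)
  open import Algebra.Properties.Semiring.Exp semiring using (^-congˡ; ^-assocʳ)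
  open IntegerCoefficientSolver commRing public using (solve; _:=_; _:+_; _:*_; :-_; _:-_; con)
  open import Data.Nat.Divisibility using (_∣_; divides)

  *-nonzero : ∀ {x y} → x ≉ 0# → y ≉ 0# → x * y ≉ 0#
  *-nonzero {x} {y} x≉0 y≉0 xy≈0 with inverse x x≉0
  ... | x' , xx'≈1 = y≉0 (begin
      y             ≈⟨ sym (*-identityˡ y) ⟩
      1# * y        ≈⟨ *-congʳ (sym xx'≈1) ⟩
      (x * x') * y  ≈⟨ solve 3 (λ a b c → (a :* b) :* c := b :* (a :* c)) refl x x' y ⟩
      x' * (x * y)  ≈⟨ *-congˡ xy≈0 ⟩
      x' * 0#       ≈⟨ zeroʳ x' ⟩
      0#            ∎)

  zero-product : ∀ {x y} → x * y ≈ 0# → x ≈ 0# ⊎ y ≈ 0#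
  zero-product {x} {y} xy≈0 with x ≈? 0# | y ≈? 0#
  ... | yes x≈0 | _       = inj₁ x≈0
  ... | no _    | yes y≈0 = inj₂ y≈0
  ... | no x≉0  | no y≉0  = ⊥-elim (*-nonzero x≉0 y≉0 xy≈0)

  x-y≈0⇒x≈y : ∀ {x y} → x - y ≈ 0# → x ≈ y
  x-y≈0⇒x≈y {x} {y} x-y≈0 = begin
      x            ≈⟨ solve 2 (λ a b → a := (a :- b) :+ b) refl x y ⟩
      (x - y) + y  ≈⟨ +-congʳ x-y≈0 ⟩
      0# + y       ≈⟨ +-identityˡ y ⟩
      y            ∎

  *-cancelʳ-nonzero : ∀ {x y z} → z ≉ 0# → x * z ≈ y * z → x ≈ y
  *-cancelʳ-nonzero {x} {y} {z} z≉0 xz≈yz with zero-product {x - y} {z} (begin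
      (x - y) * z    ≈⟨ solve 3 (λ a b c → (a :- b) :* c := a :* c :- b :* c) refl x y z ⟩
      x * z - y * z  ≈⟨ +-congʳ xz≈yz ⟩
      y * z - y * z  ≈⟨ -‿inverseʳ (y * z) ⟩
      0#             ∎)
  ... | inj₁ x-y≈0 = x-y≈0⇒x≈y x-y≈0
  ... | inj₂ z≈0   = ⊥-elim (z≉0 z≈0)

  -1≉0 : - 1# ≉ 0#
  -1≉0 -1≈0 = 1≉0 (trans (sym (-‿involutive 1#)) (trans (-‿cong -1≈0) -0#≈0#))

  inv : Carrier → Carrier
  inv x with x ≈? 0#
  ... | yes _  = 0#
  ... | no x≉0 = proj₁ (inverse x x≉0)

  *-inverseʳ : ∀ {x} → x ≉ 0# → x * inv x ≈ 1#
  *-inverseʳ {x} x≉0 with x ≈? 0#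
  ... | yes x≈0 = ⊥-elim (x≉0 x≈0)
  ... | no x≉0′ = proj₂ (inverse x x≉0′)

  *-inverseˡ : ∀ {x} → x ≉ 0# → inv x * x ≈ 1#
  *-inverseˡ x≉0 = trans (*-comm _ _) (*-inverseʳ x≉0)

  pow≡^ : ∀ x n → pow K x n ≡ x ^ᴿ n
  pow≡^ x zero    = ≡.refl
  pow≡^ x (suc n) = ≡.cong (x *_) (pow≡^ x n)

  pow-cong : ∀ {x y} n → x ≈ y → pow K x n ≈ pow K y n
  pow-cong {x} {y} n x≈y rewrite pow≡^ x n | pow≡^ y n = ^-congˡ n x≈y

  pow-* : ∀ x m n → pow K x (m ℕ.* n) ≈ pow K (pow K x m) n
  pow-* x m n rewrite pow≡^ x (m ℕ.* n) | pow≡^ x m | pow≡^ (x ^ᴿ m) n = sym (^-assocʳ x m n)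

  pow-1# : ∀ n → pow K 1# n ≈ 1#
  pow-1# zero    = refl
  pow-1# (suc n) = trans (*-identityˡ _) (pow-1# n)

  pow-0# : ∀ {n} → 1 ≤ n → pow K 0# n ≈ 0#
  pow-0# {suc n} _ = zeroˡ _

  pow-[-1]-odd : ∀ t → pow K (- 1#) (1 ℕ.+ t ℕ.* 2) ≈ - 1#
  pow-[-1]-odd t = begin
      - 1# * pow K (- 1#) (t ℕ.* 2)          ≡⟨ ≡.cong (λ e → - 1# * pow K (- 1#) e) (ℕP.*-comm t 2) ⟩
      - 1# * pow K (- 1#) (2 ℕ.* t)          ≈⟨ *-congˡ (pow-* (- 1#) 2 t) ⟩
      - 1# * pow K (pow K (- 1#) 2) t        ≈⟨ *-congˡ (trans (pow-cong t [-1]²≈1) (pow-1# t)) ⟩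
      - 1# * 1#                              ≈⟨ *-identityʳ _ ⟩
      - 1#                                   ∎
    where
    [-1]²≈1 : pow K (- 1#) 2 ≈ 1#
    [-1]²≈1 = trans (solve 1 (λ w → (:- w) :* ((:- w) :* w) := w :* (w :* w)) refl 1#) (trans (*-identityˡ _) (*-identityˡ _))

  nat≡×1# : ∀ n → nat K n ≡ n ×ᴿ 1#
  nat≡×1# zero    = ≡.refl
  nat≡×1# (suc n) = ≡.cong (1# +_) (nat≡×1# n)

  nat-+ : ∀ m n → nat K (m ℕ.+ n) ≈ nat K m + nat K n
  nat-+ m n rewrite nat≡×1# (m ℕ.+ n) | nat≡×1# m | nat≡×1# n = ×-homo-+ 1# m n

  nat-* : ∀ m n → nat K (m ℕ.* n) ≈ nat K m * nat K n
  nat-* m n rewrite nat≡×1# (m ℕ.* n) | nat≡×1# m | nat≡×1# n = ×1-homo-* m n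

  nat-multiple≈0 : ∀ {d m} → nat K d ≈ 0# → d ∣ m → nat K m ≈ 0#
  nat-multiple≈0 {d} d≈0 (divides k ≡.refl) = trans (nat-* k d) (trans (*-congˡ d≈0) (zeroʳ _))

  Tr-cong : ∀ p m {x y} → x ≈ y → Tr K p m x ≈ Tr K p m y
  Tr-cong p zero    x≈y = refl
  Tr-cong p (suc m) x≈y = +-cong (pow-cong (p ^ m) x≈y) (Tr-cong p m x≈y)

module Enumeration (K : FiniteField) where

  open FieldProperties K
  open ≈-Reasoning
  open import Function.Bundles public using (Inverse)
  open import Function.Definitions using (Congruent)
  open import Data.Fin.Permutation using (Permutation′; permutation; _⟨$⟩ʳ_)

  index : Carrier → Fin q
  index x = proj₁ (enum-surj x)

  enum-index : ∀ x → enum (index x) ≈ x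
  enum-index x = proj₂ (enum-surj x)

  index-cong : ∀ {x y} → x ≈ y → index x ≡ index y
  index-cong {x} {y} x≈y = enum-inj _ _ (trans (enum-index x) (trans x≈y (sym (enum-index y))))

  index-enum : ∀ i → index (enum i) ≡ i
  index-enum i = enum-inj _ _ (enum-index (enum i))

  index-injective : ∀ {x y} → index x ≡ index y → x ≈ y
  index-injective {x} {y} eq = trans (sym (enum-index x)) (trans (reflexive (≡.cong enum eq)) (enum-index y))

  enum-≉ : ∀ {i x} → i ≢ index x → enum i ≉ x
  enum-≉ {i} i≢x e = i≢x (≡.trans (≡.sym (index-enum i)) (index-cong e))

  2≤q : 2 ≤ q
  2≤q = two-distinct (index 0#) (index 1#) (λ e → 1≉0 (sym (index-injective e)))
    where
    two-distinct : ∀ {m} (i j : Fin m) → i ≢ j → 2 ≤ m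
    two-distinct {suc zero}    zero zero i≢j = ⊥-elim (i≢j ≡.refl)
    two-distinct {suc (suc m)} _    _    _   = s≤s (s≤s z≤n)

  1≤q : 1 ≤ q
  1≤q = ℕP.<⇒≤ 2≤q

  q≡1+[q-1] : q ≡ suc (q ∸ 1)
  q≡1+[q-1] = ≡.sym (ℕP.m+[n∸m]≡n 1≤q)

  setoidInverse : (f g : Carrier → Carrier) → Congruent _≈_ _≈_ f → Congruent _≈_ _≈_ g →
            (∀ y → f (g y) ≈ y) → (∀ x → g (f x) ≈ x) → Inverse setoid setoid
  setoidInverse f g f-cong g-cong fg gf = record
    { to        = f
    ; from      = g
    ; to-cong   = f-cong
    ; from-cong = g-cong
    ; inverse   = (λ {x} y≈gx → trans (f-cong y≈gx) (fg x)) , (λ {x} y≈fx → trans (g-cong y≈fx) (gf x))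
    }

  module _ (φ : Inverse setoid setoid) where

    open Inverse φ

    reindexing : Permutation′ q
    reindexing = permutation (index ∘ to ∘ enum) (index ∘ from ∘ enum) (along to-cong strictlyInverseˡ) (along from-cong strictlyInverseʳ)
      where
      along : ∀ {f g : Carrier → Carrier} → Congruent _≈_ _≈_ f → (∀ y → f (g y) ≈ y) → ∀ i → index (f (enum (index (g (enum i))))) ≡ i
      along f-cong fg i = ≡.trans (index-cong (trans (f-cong (enum-index _)) (fg (enum i)))) (index-enum i)

    sum-reindex : (M : CommutativeMonoid 0ℓ 0ℓ) (h : Carrier → CommutativeMonoid.Carrier M) →
                  Congruent _≈_ (CommutativeMonoid._≈_ M) h →
                  CommutativeMonoid._≈_ M (MSum.sum M (h ∘ enum)) (MSum.sum M (h ∘ to ∘ enum))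
    sum-reindex M h h-cong = M.trans (sum-permute (h ∘ enum) reindexing)
      (sum-cong-≋ {x = λ i → h (enum (reindexing ⟨$⟩ʳ i))} {y = h ∘ to ∘ enum} (λ i → h-cong (enum-index _)))
      where
      module M = CommutativeMonoid M
      open import Algebra.Properties.CommutativeMonoid.Sum M using (sum-permute; sum-cong-≋)

module Fermat (K : FiniteField) where

  open FieldProperties K
  open ≈-Reasoning
  open Enumeration K
  open import Algebra.Properties.CommutativeMonoid.Sum *-commutativeMonoid
    using (sum-cong-≋; ∑-distrib-+) renaming (sum to prod)

  -- Replacing 0 by 1 lets the product over all of K play the role of the product over K^×.
  unitPart : Carrier → Carrier
  unitPart y with y ≈? 0#
  ... | yes _ = 1#
  ... | no _  = y

  unitPart-cong : ∀ {x y} → x ≈ y → unitPart x ≈ unitPart y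
  unitPart-cong {x} {y} x≈y with x ≈? 0# | y ≈? 0#
  ... | yes _   | yes _   = refl
  ... | yes x≈0 | no y≉0  = ⊥-elim (y≉0 (trans (sym x≈y) x≈0))
  ... | no x≉0  | yes y≈0 = ⊥-elim (x≉0 (trans x≈y y≈0))
  ... | no _    | no _    = x≈y

  unitPart-nonzero : ∀ y → unitPart y ≉ 0#
  unitPart-nonzero y with y ≈? 0#
  ... | yes _  = 1≉0
  ... | no y≉0 = y≉0

  prod-nonzero : ∀ {n} (f : Fin n → Carrier) → (∀ i → f i ≉ 0#) → prod f ≉ 0#
  prod-nonzero {zero}  f _  = 1≉0
  prod-nonzero {suc n} f f≉0 = *-nonzero (f≉0 zero) (prod-nonzero (f ∘ suc) (f≉0 ∘ suc))

  fermat : ∀ x → pow K x q ≈ x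
  fermat x with x ≈? 0#
  ... | yes x≈0 = trans (pow-cong q x≈0) (trans (pow-0# 1≤q) (sym x≈0))
  ... | no x≉0  = begin
      pow K x q           ≈⟨ sym (*-identityˡ _) ⟩
      1# * pow K x q      ≡⟨ ≡.cong (1# *_) (pow≡^ x q) ⟩
      1# * x ^ᴿ q         ≈⟨ sym (CommutativeMonoidSum.sum-constant-except *-commutativeMonoid
                                    scale (index 0#) 1# x scale-at-0 scale-off-0) ⟩
      prod scale * x      ≈⟨ *-congʳ prod-scale≈1 ⟩
      1# * x              ≈⟨ *-identityˡ x ⟩
      x                   ∎
    where
    scale : Fin q → Carrier
    scale i with enum i ≈? 0#
    ... | yes _ = 1#
    ... | no _  = x
    scale-at-0 : scale (index 0#) ≈ 1#
    scale-at-0 with enum (index 0#) ≈? 0#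
    ... | yes _     = refl
    ... | no e≉0    = ⊥-elim (e≉0 (enum-index 0#))
    scale-off-0 : ∀ i → i ≢ index 0# → scale i ≈ x
    scale-off-0 i i≢0 with enum i ≈? 0#
    ... | yes e≈0 = ⊥-elim (enum-≉ i≢0 e≈0)
    ... | no _    = refl
    unitPart-scaled : ∀ i → unitPart (x * enum i) ≈ scale i * unitPart (enum i)
    unitPart-scaled i with enum i ≈? 0# | (x * enum i) ≈? 0#
    ... | yes _   | yes _    = sym (*-identityˡ _)
    ... | yes e≈0 | no xe≉0  = ⊥-elim (xe≉0 (trans (*-congˡ e≈0) (zeroʳ x)))
    ... | no e≉0  | yes xe≈0 = ⊥-elim (*-nonzero x≉0 e≉0 xe≈0)
    ... | no _    | no _     = refl
    U : Carrier
    U = prod (unitPart ∘ enum)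
    multiplication-by-x : Inverse setoid setoid
    multiplication-by-x = setoidInverse (x *_) (inv x *_) *-congˡ *-congˡ
      (λ y → trans (sym (*-assoc _ _ _)) (trans (*-congʳ (*-inverseʳ x≉0)) (*-identityˡ y)))
      (λ y → trans (sym (*-assoc _ _ _)) (trans (*-congʳ (*-inverseˡ x≉0)) (*-identityˡ y)))
    U≈scale*U : 1# * U ≈ prod scale * U
    U≈scale*U = begin
      1# * U                                       ≈⟨ *-identityˡ U ⟩
      U                                            ≈⟨ sum-reindex multiplication-by-x *-commutativeMonoid unitPart unitPart-cong ⟩
      prod (λ i → unitPart (x * enum i))           ≈⟨ sum-cong-≋ unitPart-scaled ⟩
      prod (λ i → scale i * unitPart (enum i))     ≈⟨ ∑-distrib-+ scale (unitPart ∘ enum) ⟩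
      prod scale * U                               ∎
    prod-scale≈1 : prod scale ≈ 1#
    prod-scale≈1 = sym (*-cancelʳ-nonzero (prod-nonzero (unitPart ∘ enum) (unitPart-nonzero ∘ enum)) U≈scale*U)

  x^[q-1]≈1 : ∀ {x} → x ≉ 0# → pow K x (q ∸ 1) ≈ 1#
  x^[q-1]≈1 {x} x≉0 = sym (*-cancelʳ-nonzero x≉0 (begin
      1# * x                   ≈⟨ *-identityˡ x ⟩
      x                        ≈⟨ sym (fermat x) ⟩
      pow K x q                ≡⟨ ≡.cong (pow K x) (≡.sym (ℕP.m+[n∸m]≡n 1≤q)) ⟩
      x * pow K x (q ∸ 1)      ≈⟨ *-comm x _ ⟩
      pow K x (q ∸ 1) * x      ∎))

  pow-1+m*[q-1] : ∀ x m → pow K x (1 ℕ.+ m ℕ.* (q ∸ 1)) ≈ x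
  pow-1+m*[q-1] x m with x ≈? 0#
  ... | yes x≈0 = trans (pow-cong (1 ℕ.+ m ℕ.* (q ∸ 1)) x≈0) (trans (pow-0# {1 ℕ.+ m ℕ.* (q ∸ 1)} (s≤s z≤n)) (sym x≈0))
  ... | no x≉0  = begin
      x * pow K x (m ℕ.* (q ∸ 1))        ≡⟨ ≡.cong (λ e → x * pow K x e) (ℕP.*-comm m (q ∸ 1)) ⟩
      x * pow K x ((q ∸ 1) ℕ.* m)        ≈⟨ *-congˡ (pow-* x (q ∸ 1) m) ⟩
      x * pow K (pow K x (q ∸ 1)) m      ≈⟨ *-congˡ (trans (pow-cong m (x^[q-1]≈1 x≉0)) (pow-1# m)) ⟩
      x * 1#                             ≈⟨ *-identityʳ x ⟩
      x                                  ∎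

  power-map : ∀ s → 1 ≤ s → Coprime s (q ∸ 1) → Inverse setoid setoid
  power-map s 1≤s s⊥q-1 with Arithmetic.coprime⇒inverse-mod s (q ∸ 1) 1≤s s⊥q-1
  ... | a , m , sa≡1+m[q-1] = setoidInverse (λ x → pow K x s) (λ x → pow K x a) (pow-cong s) (pow-cong a)
      (λ x → trans (sym (pow-* x a s)) (trans (reflexive (≡.cong (pow K x) (ℕP.*-comm a s))) (x^sa≈x x)))
      (λ x → trans (sym (pow-* x s a)) (x^sa≈x x))
    where
    x^sa≈x : ∀ x → pow K x (s ℕ.* a) ≈ x
    x^sa≈x x = ≡.subst (λ e → pow K x e ≈ x) (≡.sym sa≡1+m[q-1]) (pow-1+m*[q-1] x m)

module Polynomials (K : FiniteField) where

  open FieldProperties K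
  open ≈-Reasoning
  open import Data.List using (replicate; _++_)
  import Data.List.Properties as ListP
  open import Data.List.Relation.Unary.All using (All; []; _∷_)
  open import Data.List.Relation.Unary.Unique.Setoid setoid public using (Unique; []; _∷_)

  eval : List Carrier → Carrier → Carrier
  eval []       x = 0#
  eval (c ∷ cs) x = c + x * eval cs x

  LeadingNonzero : List Carrier → Set
  LeadingNonzero []           = ⊥
  LeadingNonzero (c ∷ [])     = c ≉ 0#
  LeadingNonzero (_ ∷ d ∷ ds) = LeadingNonzero (d ∷ ds)

  LeadingNonzero-∷ : ∀ c cs → LeadingNonzero cs → LeadingNonzero (c ∷ cs)
  LeadingNonzero-∷ c (d ∷ ds) lead = lead

  IsRoot : List Carrier → Carrier → Set
  IsRoot cs r = eval cs r ≈ 0#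

  -- Quotient of cs by X − a (synthetic division).
  quotient : List Carrier → Carrier → List Carrier
  quotient []           a = []
  quotient (c ∷ [])     a = []
  quotient (c ∷ d ∷ ds) a = eval (d ∷ ds) a ∷ quotient (d ∷ ds) a

  eval-∷-[] : ∀ c x → eval (c ∷ []) x ≈ c
  eval-∷-[] c x = trans (+-congˡ (zeroʳ x)) (+-identityʳ c)

  division-by-root : ∀ c cs x a → eval (c ∷ cs) x ≈ (x - a) * eval (quotient (c ∷ cs) a) x + eval (c ∷ cs) a
  division-by-root c []       x a = solve 3 (λ c x a → c :+ x :* con ℤ.0ℤ := (x :- a) :* con ℤ.0ℤ :+ (c :+ a :* con ℤ.0ℤ)) refl c x a
  division-by-root c (d ∷ ds) x a = begin
      c + x * E x                           ≈⟨ +-congˡ (*-congˡ (division-by-root d ds x a)) ⟩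
      c + x * ((x - a) * Q + E a)           ≈⟨ solve 5 (λ c x a q e → c :+ x :* ((x :- a) :* q :+ e)
                                                             := (x :- a) :* (e :+ x :* q) :+ (c :+ a :* e)) refl c x a Q (E a) ⟩
      (x - a) * (E a + x * Q) + (c + a * E a) ∎
    where
    E : Carrier → Carrier
    E = eval (d ∷ ds)
    Q : Carrier
    Q = eval (quotient (d ∷ ds) a) x

  length-quotient : ∀ c cs a → length (quotient (c ∷ cs) a) ≡ length cs
  length-quotient c []       a = ≡.refl
  length-quotient c (d ∷ ds) a = ≡.cong suc (length-quotient d ds a)

  LeadingNonzero-quotient : ∀ c d ds a → LeadingNonzero (d ∷ ds) → LeadingNonzero (quotient (c ∷ d ∷ ds) a)
  LeadingNonzero-quotient c d []       a d≉0 = λ e → d≉0 (trans (sym (eval-∷-[] d a)) e)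
  LeadingNonzero-quotient c d (e ∷ es) a lead = LeadingNonzero-∷ (eval (d ∷ e ∷ es) a) (quotient (d ∷ e ∷ es) a) (LeadingNonzero-quotient d e es a lead)

  roots-bound : ∀ cs rs → LeadingNonzero cs → Unique rs → All (IsRoot cs) rs → length rs < length cs
  roots-bound []               rs       () _ _
  roots-bound (c ∷ cs)         []       _  _ _ = s≤s z≤n
  roots-bound (c ∷ [])         (a ∷ rs) c≉0 _ (a-root ∷ _) = ⊥-elim (c≉0 (trans (sym (eval-∷-[] c a)) a-root))
  roots-bound (c ∷ d ∷ ds)     (a ∷ rs) lead (a≉rs ∷ rs-unique) (a-root ∷ rs-roots) =
    s≤s (≡.subst (length rs <_) (length-quotient c (d ∷ ds) a)
          (roots-bound (quotient (c ∷ d ∷ ds) a) rs (LeadingNonzero-quotient c d ds a lead) rs-unique (roots-of-quotient a≉rs rs-roots)))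
    where
    roots-of-quotient : ∀ {bs} → All (a ≉_) bs → All (IsRoot (c ∷ d ∷ ds)) bs → All (IsRoot (quotient (c ∷ d ∷ ds) a)) bs
    roots-of-quotient []                 []                = []
    roots-of-quotient {b ∷ _} (a≉b ∷ a≉bs) (b-root ∷ bs-roots) with zero-product {b - a} (begin
        (b - a) * eval (quotient (c ∷ d ∷ ds) a) b                          ≈⟨ sym (+-identityʳ _) ⟩
        (b - a) * eval (quotient (c ∷ d ∷ ds) a) b + 0#                     ≈⟨ +-congˡ (sym a-root) ⟩
        (b - a) * eval (quotient (c ∷ d ∷ ds) a) b + eval (c ∷ d ∷ ds) a    ≈⟨ sym (division-by-root c (d ∷ ds) b a) ⟩
        eval (c ∷ d ∷ ds) b                                                 ≈⟨ b-root ⟩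
        0#                                                                  ∎)
    ... | inj₁ b-a≈0 = ⊥-elim (a≉b (sym (x-y≈0⇒x≈y b-a≈0)))
    ... | inj₂ q≈0   = q≈0 ∷ roots-of-quotient a≉bs bs-roots

  _⊕_ : List Carrier → List Carrier → List Carrier
  []       ⊕ g        = g
  (a ∷ as) ⊕ []       = a ∷ as
  (a ∷ as) ⊕ (b ∷ bs) = (a + b) ∷ (as ⊕ bs)

  eval-⊕ : ∀ f g x → eval (f ⊕ g) x ≈ eval f x + eval g x
  eval-⊕ []       g        x = sym (+-identityˡ _)
  eval-⊕ (a ∷ as) []       x = sym (+-identityʳ _)
  eval-⊕ (a ∷ as) (b ∷ bs) x = begin
      (a + b) + x * eval (as ⊕ bs) x               ≈⟨ +-congˡ (*-congˡ (eval-⊕ as bs x)) ⟩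
      (a + b) + x * (eval as x + eval bs x)        ≈⟨ solve 5 (λ a b x f g → (a :+ b) :+ x :* (f :+ g) := (a :+ x :* f) :+ (b :+ x :* g))
                                                               refl a b x (eval as x) (eval bs x) ⟩
      (a + x * eval as x) + (b + x * eval bs x)    ∎

  length-⊕ : ∀ f g → length g < length f → length (f ⊕ g) ≡ length f
  length-⊕ (a ∷ as) []       _         = ≡.refl
  length-⊕ (a ∷ as) (b ∷ bs) (s≤s g<f) = ≡.cong suc (length-⊕ as bs g<f)

  LeadingNonzero-⊕ : ∀ f g → length g < length f → LeadingNonzero f → LeadingNonzero (f ⊕ g)
  LeadingNonzero-⊕ (a ∷ as)      []       _         lead = lead
  LeadingNonzero-⊕ (a ∷ a′ ∷ as) (b ∷ bs) (s≤s g<f) lead = LeadingNonzero-∷ _ ((a′ ∷ as) ⊕ bs) (LeadingNonzero-⊕ (a′ ∷ as) bs g<f lead)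

  X^ : ℕ → List Carrier
  X^ d = replicate d 0# ++ (1# ∷ [])

  eval-X^ : ∀ d x → eval (X^ d) x ≈ pow K x d
  eval-X^ zero    x = eval-∷-[] 1# x
  eval-X^ (suc d) x = trans (+-identityˡ _) (*-congˡ (eval-X^ d x))

  length-X^ : ∀ d → length (X^ d) ≡ suc d
  length-X^ d = ≡.trans (ListP.length-++ (replicate d 0#)) (≡.trans (≡.cong (ℕ._+ 1) (ListP.length-replicate d)) (ℕP.+-comm d 1))

  LeadingNonzero-X^ : ∀ d → LeadingNonzero (X^ d)
  LeadingNonzero-X^ zero    = 1≉0
  LeadingNonzero-X^ (suc d) = LeadingNonzero-∷ 0# (X^ d) (LeadingNonzero-X^ d)

module PrimeCharacteristic (K : FiniteField) (p : ℕ) (p-prime : Prime p) (char-p : FiniteField._≈_ K (nat K p) (FiniteField.0# K)) where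

  open FieldProperties K
  open ≈-Reasoning
  open import Data.Nat using (NonZero; _!)
  open import Data.Nat.Divisibility using (_∣_; divides; ∣⇒≤; m∣m*n)
  open import Data.Nat.DivMod using (m*[n/m]≡n)
  open import Data.Nat.Primality using (prime⇒irreducible; prime⇒nonZero; prime⇒nonTrivial; euclidsLemma)
  open import Data.Nat.Coprimality using (coprime-Bézout)
  open import Data.Nat.GCD using (module Bézout)
  open import Data.Nat.Combinatorics using (_C_; nCn≡1; k![n∸k]!∣n!)
  open import Data.Nat.Combinatorics.Specification using (nCk≡n!/k![n-k]!)
  open import Algebra.Properties.Monoid.Mult +-monoid using (×-homo-1; ×-congʳ) renaming (_×_ to _×ᴿ_)
  open import Algebra.Properties.Semiring.Mult semiring using (×-assoc-*)
  import Algebra.Properties.CommutativeSemiring.Binomial commutativeSemiring as Binomial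

  instance
    p≢0 : NonZero p
    p≢0 = prime⇒nonZero p-prime

  2≤p : 2 ≤ p
  2≤p = ℕ.nonTrivial⇒n>1 p {{prime⇒nonTrivial p-prime}}

  ∤-small : ∀ {d} → 0 < d → d < p → ¬ (p ∣ d)
  ∤-small {suc d} _ d<p p∣d = ℕP.<⇒≱ d<p (∣⇒≤ p∣d)

  nat≈0⇒1+a≢b : ∀ {a b} → nat K a ≈ 0# → nat K b ≈ 0# → 1 ℕ.+ a ≢ b
  nat≈0⇒1+a≢b {a} {b} a≈0 b≈0 1+a≡b = 1≉0 (begin
      1#                   ≈⟨ sym (+-identityʳ 1#) ⟩
      1# + 0#              ≈⟨ +-congˡ (sym a≈0) ⟩
      nat K (1 ℕ.+ a)      ≡⟨ ≡.cong (nat K) 1+a≡b ⟩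
      nat K b              ≈⟨ b≈0 ⟩
      0#                   ∎)

  -- Bézout: 1 is an integer combination of d and p, and both map to 0.
  nat-nonzero : ∀ {d} → 0 < d → d < p → nat K d ≉ 0#
  nat-nonzero {d} 0<d d<p d≈0 with coprime-Bézout d⊥p
    where
    d⊥p : Coprime d p
    d⊥p (c∣d , c∣p) with prime⇒irreducible p-prime c∣p
    ... | inj₁ c≡1    = c≡1
    ... | inj₂ ≡.refl = ⊥-elim (∤-small 0<d d<p c∣d)
  ... | Bézout.+- x y 1+yp≡xd = nat≈0⇒1+a≢b (nat-multiple≈0 char-p (divides y ≡.refl)) (nat-multiple≈0 d≈0 (divides x ≡.refl)) 1+yp≡xd
  ... | Bézout.-+ x y 1+xd≡yp = nat≈0⇒1+a≢b (nat-multiple≈0 d≈0 (divides x ≡.refl)) (nat-multiple≈0 char-p (divides y ≡.refl)) 1+xd≡yp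

  1≉-1 : 3 ≤ p → 1# ≉ - 1#
  1≉-1 3≤p 1≈-1 = nat-nonzero {2} (s≤s z≤n) 3≤p (begin
      1# + (1# + 0#)  ≈⟨ +-congˡ (+-identityʳ 1#) ⟩
      1# + 1#         ≈⟨ +-congˡ 1≈-1 ⟩
      1# + - 1#       ≈⟨ -‿inverseʳ 1# ⟩
      0#              ∎)

  nat-injective-≤ : ∀ {a b} → a ≤ b → b < p → nat K a ≈ nat K b → a ≡ b
  nat-injective-≤ {a} {b} a≤b b<p a≈b with ℕP.m≤n⇒∃[o]m+o≡n a≤b
  ... | zero  , a+0≡b = ≡.trans (≡.sym (ℕP.+-identityʳ a)) a+0≡b
  ... | suc d , a+d≡b = ⊥-elim (nat-nonzero (s≤s z≤n) (ℕP.≤-<-trans (ℕP.m≤n+m (suc d) a) (≡.subst (_< p) (≡.sym a+d≡b) b<p)) (begin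
      nat K (suc d)                          ≈⟨ solve 2 (λ a d → d := :- a :+ (a :+ d)) refl (nat K a) _ ⟩
      - nat K a + (nat K a + nat K (suc d))  ≈⟨ +-congˡ (sym (nat-+ a (suc d))) ⟩
      - nat K a + nat K (a ℕ.+ suc d)        ≡⟨ ≡.cong (λ t → - nat K a + nat K t) a+d≡b ⟩
      - nat K a + nat K b                    ≈⟨ +-congˡ (sym a≈b) ⟩
      - nat K a + nat K a                    ≈⟨ -‿inverseˡ (nat K a) ⟩
      0#                                     ∎))

  nat-injective : ∀ {i j} → i < p → j < p → nat K i ≈ nat K j → i ≡ j
  nat-injective {i} {j} i<p j<p i≈j with ℕP.≤-total i j
  ... | inj₁ i≤j = nat-injective-≤ i≤j j<p i≈j
  ... | inj₂ j≤i = ≡.sym (nat-injective-≤ j≤i i<p (sym i≈j))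

  ∤-factorial : ∀ m → m < p → ¬ (p ∣ m !)
  ∤-factorial zero    _   p∣1 = ℕP.<⇒≱ 2≤p (∣⇒≤ p∣1)
  ∤-factorial (suc m) m<p p∣m! with euclidsLemma (suc m) (m !) p-prime p∣m!
  ... | inj₁ p∣m  = ∤-small (s≤s z≤n) m<p p∣m
  ... | inj₂ p∣m! = ∤-factorial m (ℕP.<-trans (ℕP.n<1+n m) m<p) p∣m!

  ∣-binomial : ∀ k → 0 < k → k < p → p ∣ p C k
  ∣-binomial k 0<k k<p with euclidsLemma (k ! ℕ.* (p ∸ k) !) (p C k) p-prime p∣denominator*binomial
    where
    instance
      denominator≢0 : NonZero (k ! ℕ.* (p ∸ k) !)
      denominator≢0 = k ℕP.!* (p ∸ k) !≢0
    p∣denominator*binomial : p ∣ k ! ℕ.* (p ∸ k) ! ℕ.* (p C k)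
    p∣denominator*binomial = ≡.subst (p ∣_)
      (≡.trans (≡.sym (m*[n/m]≡n (k![n∸k]!∣n! (ℕP.<⇒≤ k<p))))
               (≡.cong (k ! ℕ.* (p ∸ k) ! ℕ.*_) (≡.sym (nCk≡n!/k![n-k]! (ℕP.<⇒≤ k<p)))))
      (p∣p! p)
      where
      p∣p! : ∀ n → {{NonZero n}} → n ∣ n !
      p∣p! (suc n) = m∣m*n (n !)
  ... | inj₂ p∣binomial = p∣binomial
  ... | inj₁ p∣denominator with euclidsLemma (k !) ((p ∸ k) !) p-prime p∣denominator
  ...   | inj₁ p∣k!   = ⊥-elim (∤-factorial k k<p p∣k!)
  ...   | inj₂ p∣p-k! = ⊥-elim (∤-factorial (p ∸ k) (ℕP.∸-monoʳ-< {p} {k} {0} 0<k (ℕP.<⇒≤ k<p)) p∣p-k!)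

  frobenius-+ : ∀ x y → pow K (x + y) p ≈ pow K x p + pow K y p
  frobenius-+ x y = go p {{p≢0}} (λ k 0<k k<p → nat-multiple≈0 char-p (∣-binomial k 0<k k<p))
    where
    go : ∀ n → {{NonZero n}} → (∀ k → 0 < k → k < n → nat K (n C k) ≈ 0#) → pow K (x + y) n ≈ pow K x n + pow K y n
    go (suc m) binomial≈0 = begin
        pow K (x + y) (suc m)                  ≡⟨ pow≡^ (x + y) (suc m) ⟩
        (x + y) ^ᴿ suc m                       ≈⟨ Binomial.theorem (suc m) x y ⟩
        Binomial.binomialExpansion x y (suc m) ≈⟨ +-congˡ (sum-supported-at (term ∘ suc) (Fin.fromℕ m) middle≈0) ⟩
        term zero + term (suc (Fin.fromℕ m))   ≈⟨ +-cong first last ⟩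
        pow K y (suc m) + pow K x (suc m)      ≈⟨ +-comm _ _ ⟩
        pow K x (suc m) + pow K y (suc m)      ∎
      where
      open CommutativeMonoidSum +-commutativeMonoid using (sum-supported-at)
      term : Fin (suc (suc m)) → Carrier
      term = Binomial.binomialTerm x y (suc m)
      first : term zero ≈ pow K y (suc m)
      first = trans (×-homo-1 _) (trans (*-identityˡ _) (reflexive (≡.sym (pow≡^ y (suc m)))))
      last : term (suc (Fin.fromℕ m)) ≈ pow K x (suc m)
      last rewrite FinP.toℕ-fromℕ m | nCn≡1 (suc m) | ℕP.n∸n≡0 m =
        trans (×-homo-1 _) (trans (*-identityʳ _) (reflexive (≡.sym (pow≡^ x (suc m)))))
      middle≈0 : ∀ j → j ≢ Fin.fromℕ m → term (suc j) ≈ 0#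
      middle≈0 j j≢m = begin
          term (suc j)                                  ≈⟨ ×≈nat* {suc m C suc (toℕ j)} ⟩
          nat K (suc m C suc (toℕ j)) * Binomial.binomial x y (suc m) (suc j) ≈⟨ *-congʳ (binomial≈0 (suc (toℕ j)) (s≤s z≤n) (s≤s j<m)) ⟩
          0# * Binomial.binomial x y (suc m) (suc j)    ≈⟨ zeroˡ _ ⟩
          0#                                            ∎
        where
        j<m : toℕ j < m
        j<m = ℕP.≤∧≢⇒< (ℕP.≤-pred (FinP.toℕ<n j)) (λ e → j≢m (FinP.toℕ-injective (≡.trans e (≡.sym (FinP.toℕ-fromℕ m)))))
        ×≈nat* : ∀ {n z} → n ×ᴿ z ≈ nat K n * z
        ×≈nat* {n} {z} = trans (×-congʳ n (sym (*-identityˡ z))) (trans (sym (×-assoc-* n 1# z)) (*-congʳ (reflexive (≡.sym (nat≡×1# n)))))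

  frobenius^-+ : ∀ i x y → pow K (x + y) (p ^ i) ≈ pow K x (p ^ i) + pow K y (p ^ i)
  frobenius^-+ zero    x y = trans (*-identityʳ _) (+-cong (sym (*-identityʳ _)) (sym (*-identityʳ _)))
  frobenius^-+ (suc i) x y = begin
      pow K (x + y) (p ℕ.* p ^ i)                       ≈⟨ pow-* (x + y) p (p ^ i) ⟩
      pow K (pow K (x + y) p) (p ^ i)                   ≈⟨ pow-cong (p ^ i) (frobenius-+ x y) ⟩
      pow K (pow K x p + pow K y p) (p ^ i)             ≈⟨ frobenius^-+ i (pow K x p) (pow K y p) ⟩
      pow K (pow K x p) (p ^ i) + pow K (pow K y p) (p ^ i) ≈⟨ sym (+-cong (pow-* x p (p ^ i)) (pow-* y p (p ^ i))) ⟩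
      pow K x (p ℕ.* p ^ i) + pow K y (p ℕ.* p ^ i)     ∎

  nat-fixed-by-frobenius : ∀ j → pow K (nat K j) p ≈ nat K j
  nat-fixed-by-frobenius zero    = pow-0# (ℕP.<-trans (s≤s z≤n) 2≤p)
  nat-fixed-by-frobenius (suc j) = begin
      pow K (1# + nat K j) p          ≈⟨ frobenius-+ 1# (nat K j) ⟩
      pow K 1# p + pow K (nat K j) p  ≈⟨ +-cong (pow-1# p) (nat-fixed-by-frobenius j) ⟩
      1# + nat K j                    ∎

  -- The p + 1 elements 0, …, p − 1 and y would be distinct roots of X^p − X.
  fixed-by-frobenius⇒prime-field : ∀ y → pow K y p ≈ y → ∃ λ (j : Fin p) → y ≈ nat K (toℕ j)
  fixed-by-frobenius⇒prime-field y y^p≈y with FinP.any? (λ (j : Fin p) → y ≈? nat K (toℕ j))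
  ... | yes found = found
  ... | no  y∉𝔽p  = ⊥-elim (ℕP.<-irrefl #roots≡p+1 bound)
    where
    open Polynomials K
    import Data.List.Properties as ListP
    open import Data.List.Relation.Unary.All using (All; _∷_)
    open import Data.List.Relation.Unary.All.Properties using (tabulate⁺)
    import Data.List.Relation.Unary.Unique.Setoid.Properties as Unique
    -X : List Carrier
    -X = 0# ∷ - 1# ∷ []
    2<p+1 : length -X < length (X^ p)
    2<p+1 = ℕP.≤-trans (s≤s 2≤p) (ℕP.≤-reflexive (≡.sym (length-X^ p)))
    roots : List Carrier
    roots = y ∷ tabulate (λ (j : Fin p) → nat K (toℕ j))
    #roots≡p+1 : length roots ≡ length (X^ p ⊕ -X)
    #roots≡p+1 = ≡.trans (≡.cong suc (ListP.length-tabulate _)) (≡.sym (≡.trans (length-⊕ (X^ p) -X 2<p+1) (length-X^ p)))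
    eval-[-X] : ∀ z → eval -X z ≈ - z
    eval-[-X] z = trans (solve 2 (λ z w → con ℤ.0ℤ :+ z :* (:- w :+ z :* con ℤ.0ℤ) := :- (z :* w)) refl z 1#) (-‿cong (*-identityʳ z))
    fixed⇒root : ∀ z → pow K z p ≈ z → IsRoot (X^ p ⊕ -X) z
    fixed⇒root z z^p≈z = begin
        eval (X^ p ⊕ -X) z         ≈⟨ eval-⊕ (X^ p) -X z ⟩
        eval (X^ p) z + eval -X z  ≈⟨ +-cong (trans (eval-X^ p z) z^p≈z) (eval-[-X] z) ⟩
        z - z                      ≈⟨ -‿inverseʳ z ⟩
        0#                         ∎
    bound : length roots < length (X^ p ⊕ -X)
    bound = roots-bound (X^ p ⊕ -X) roots
      (LeadingNonzero-⊕ (X^ p) -X 2<p+1 (LeadingNonzero-X^ p))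
      (tabulate⁺ (λ j y≈j → y∉𝔽p (j , y≈j)) ∷ Unique.tabulate⁺ setoid (FinP.toℕ-injective ∘ nat-injective (FinP.toℕ<n _) (FinP.toℕ<n _)))
      (fixed⇒root y y^p≈y ∷ tabulate⁺ (λ j → fixed⇒root _ (nat-fixed-by-frobenius (toℕ j))))

module Trace (K : FiniteField) (p n : ℕ) (p-prime : Prime p) (char-p : FiniteField._≈_ K (nat K p) (FiniteField.0# K))
             (q≡p^n : FiniteField.q K ≡ p ^ n) where

  open FieldProperties K
  open ≈-Reasoning
  open Enumeration K using (enum-index; 2≤q)
  open Fermat K using (fermat)
  open PrimeCharacteristic K p p-prime char-p
  open Polynomials K

  Tr-+ : ∀ m x y → Tr K p m (x + y) ≈ Tr K p m x + Tr K p m y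
  Tr-+ zero    x y = sym (+-identityˡ 0#)
  Tr-+ (suc m) x y = begin
      pow K (x + y) (p ^ m) + Tr K p m (x + y)                    ≈⟨ +-cong (frobenius^-+ m x y) (Tr-+ m x y) ⟩
      (pow K x (p ^ m) + pow K y (p ^ m)) + (Tr K p m x + Tr K p m y) ≈⟨ solve 4 (λ a b c d → (a :+ b) :+ (c :+ d) := (a :+ c) :+ (b :+ d)) refl _ _ _ _ ⟩
      (pow K x (p ^ m) + Tr K p m x) + (pow K y (p ^ m) + Tr K p m y) ∎

  Tr-0# : ∀ m → Tr K p m 0# ≈ 0#
  Tr-0# zero    = refl
  Tr-0# (suc m) = trans (+-cong (pow-0# (ℕP.m^n>0 p m)) (Tr-0# m)) (+-identityˡ 0#)

  Tr-minus : ∀ m x y → Tr K p m (x - y) ≈ Tr K p m x - Tr K p m y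
  Tr-minus m x y = begin
      Tr K p m (x - y)                               ≈⟨ solve 2 (λ a b → a := (a :+ b) :- b) refl _ (Tr K p m y) ⟩
      (Tr K p m (x - y) + Tr K p m y) - Tr K p m y   ≈⟨ +-congʳ (sym (Tr-+ m (x - y) y)) ⟩
      Tr K p m ((x - y) + y) - Tr K p m y            ≈⟨ +-congʳ (Tr-cong p m (solve 2 (λ a b → (a :- b) :+ b := a) refl x y)) ⟩
      Tr K p m x - Tr K p m y                        ∎

  Tr-frobenius-telescope : ∀ m y → pow K (Tr K p m y) p + y ≈ pow K y (p ^ m) + Tr K p m y
  Tr-frobenius-telescope zero    y = trans (+-congʳ (pow-0# (ℕP.<-trans (s≤s z≤n) 2≤p)))
                                          (trans (+-identityˡ y) (sym (trans (+-identityʳ _) (*-identityʳ y))))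
  Tr-frobenius-telescope (suc m) y = begin
      pow K (pow K y (p ^ m) + Tr K p m y) p + y               ≈⟨ +-congʳ (frobenius-+ _ _) ⟩
      (pow K (pow K y (p ^ m)) p + pow K (Tr K p m y) p) + y   ≈⟨ +-assoc _ _ _ ⟩
      pow K (pow K y (p ^ m)) p + (pow K (Tr K p m y) p + y)   ≈⟨ +-cong (sym (pow-* y (p ^ m) p)) (Tr-frobenius-telescope m y) ⟩
      pow K y (p ^ m ℕ.* p) + (pow K y (p ^ m) + Tr K p m y)   ≡⟨ ≡.cong (λ e → pow K y e + (pow K y (p ^ m) + Tr K p m y)) (ℕP.*-comm (p ^ m) p) ⟩
      pow K y (p ℕ.* p ^ m) + (pow K y (p ^ m) + Tr K p m y)   ∎

  Tr-fixed-by-frobenius : ∀ y → pow K (Tr K p n y) p ≈ Tr K p n y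
  Tr-fixed-by-frobenius y = +-cancelʳ (begin
      pow K (Tr K p n y) p + y    ≈⟨ Tr-frobenius-telescope n y ⟩
      pow K y (p ^ n) + Tr K p n y ≈⟨ +-congʳ (≡.subst (λ e → pow K y e ≈ y) q≡p^n (fermat y)) ⟩
      y + Tr K p n y              ≈⟨ +-comm _ _ ⟩
      Tr K p n y + y              ∎)
    where
    +-cancelʳ : ∀ {a b} → a + y ≈ b + y → a ≈ b
    +-cancelʳ {a} {b} a+y≈b+y = begin
      a             ≈⟨ solve 2 (λ a y → a := (a :+ y) :- y) refl a y ⟩
      (a + y) - y   ≈⟨ +-congʳ a+y≈b+y ⟩
      (b + y) - y   ≈⟨ solve 2 (λ b y → (b :+ y) :- y := b) refl b y ⟩
      b             ∎

  Tr-in-prime-field : ∀ y → ∃ λ (j : Fin p) → Tr K p n y ≈ nat K (toℕ j)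
  Tr-in-prime-field y = fixed-by-frobenius⇒prime-field (Tr K p n y) (Tr-fixed-by-frobenius y)

  tracePolynomial : ℕ → List Carrier
  tracePolynomial zero    = []
  tracePolynomial (suc i) = X^ (p ^ i) ⊕ tracePolynomial i

  eval-tracePolynomial : ∀ i x → eval (tracePolynomial i) x ≈ Tr K p i x
  eval-tracePolynomial zero    x = refl
  eval-tracePolynomial (suc i) x =
    trans (eval-⊕ (X^ (p ^ i)) (tracePolynomial i) x) (+-cong (eval-X^ (p ^ i) x) (eval-tracePolynomial i x))

  1+p^i≤2p^i : ∀ i → suc (p ^ i) ≤ 2 ℕ.* p ^ i
  1+p^i≤2p^i i = ℕP.≤-trans (ℕP.+-monoˡ-≤ (p ^ i) (ℕP.m^n>0 p i)) (ℕP.≤-reflexive (≡.cong (p ^ i ℕ.+_) (≡.sym (ℕP.+-identityʳ (p ^ i)))))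

  lower-terms-shorter : ∀ i → length (tracePolynomial i) < length (X^ (p ^ i))
  length-tracePolynomial : ∀ i → length (tracePolynomial (suc i)) ≡ suc (p ^ i)

  lower-terms-shorter zero    = ℕP.≤-trans (s≤s z≤n) (ℕP.≤-reflexive (≡.sym (length-X^ 1)))
  lower-terms-shorter (suc i) =
    ℕP.≤-trans (s≤s (ℕP.≤-trans (ℕP.≤-reflexive (length-tracePolynomial i)) (ℕP.≤-trans (1+p^i≤2p^i i) (ℕP.*-monoˡ-≤ (p ^ i) 2≤p))))
               (ℕP.≤-reflexive (≡.sym (length-X^ (p ^ suc i))))

  length-tracePolynomial i = ≡.trans (length-⊕ (X^ (p ^ i)) (tracePolynomial i) (lower-terms-shorter i)) (length-X^ (p ^ i))

  -- Otherwise all q elements of K would be roots of a polynomial of degree p^(n-1) < q.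
  Tr-not-identically-zero : ¬ (∀ i → Tr K p n (enum i) ≈ 0#)
  Tr-not-identically-zero = go n q≡p^n
    where
    go : ∀ k → q ≡ p ^ k → ¬ (∀ i → Tr K p k (enum i) ≈ 0#)
    go zero    q≡1     _   = ℕP.<-irrefl (≡.sym q≡1) 2≤q
    go (suc m) q≡p*p^m Tr≈0 =
      ℕP.<⇒≱ q<p^m+1 (ℕP.≤-trans (1+p^i≤2p^i m) (ℕP.≤-trans (ℕP.*-monoˡ-≤ (p ^ m) 2≤p) (ℕP.≤-reflexive (≡.sym q≡p*p^m))))
        where
        open import Data.List.Relation.Unary.All.Properties using (tabulate⁺)
        import Data.List.Relation.Unary.Unique.Setoid.Properties as Unique
        import Data.List.Properties as ListP
        q<p^m+1 : q < suc (p ^ m)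
        q<p^m+1 = ≡.subst₂ _<_ (ListP.length-tabulate enum) (length-tracePolynomial m)
          (roots-bound (tracePolynomial (suc m)) (tabulate enum)
            (LeadingNonzero-⊕ (X^ (p ^ m)) (tracePolynomial m) (lower-terms-shorter m) (LeadingNonzero-X^ (p ^ m)))
            (Unique.tabulate⁺ setoid (enum-inj _ _))
            (tabulate⁺ (λ i → trans (eval-tracePolynomial (suc m) (enum i)) (Tr≈0 i))))

module GaloisAction where

  open FinSum
  open import Data.Nat using (_%_)
  open import Data.Nat.Divisibility using (_∣_; ∣⇒≤; m%n≡0⇒n∣m)
  open import Data.Nat.DivMod using (m%n<n)
  open import Data.Nat.Primality using (prime⇒nonTrivial; euclidsLemma)

  -- The summand of σpow is local to its definition; unification against σpow-unfold names it.
  mutual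
    σpow-summand : ∀ p γ k (N : Fin p → ℕ) (i : Fin p) → Fin p → ℕ
    σpow-summand p γ k N i = _

    σpow-unfold : ∀ p γ k N i → σpow p γ k N i ≡ sumFin p (σpow-summand p γ k N i)
    σpow-unfold p γ k N i = ≡.refl

  σpow-summand-spec : ∀ p γ k N i j → σpow-summand p γ k N i j ≡ χ (modp p (γ ^ k ℕ.* toℕ j) ℕ.≟ toℕ i) ℕ.* N j
  σpow-summand-spec p γ k N i j with modp p (γ ^ k ℕ.* toℕ j) ℕ.≟ toℕ i
  ... | yes _ = ≡.sym (ℕP.+-identityʳ (N j))
  ... | no _  = ≡.refl

  σpow-as-sum : ∀ p γ k N i → σpow p γ k N i ≡ sum (λ j → χ (modp p (γ ^ k ℕ.* toℕ j) ℕ.≟ toℕ i) ℕ.* N j)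
  σpow-as-sum p γ k N i =
    ≡.trans (σpow-unfold p γ k N i)
    (≡.trans (foldr-map-tabulate (σpow-summand p γ k N i) id)
             (sum-cong-≗ {x = σpow-summand p γ k N i} (σpow-summand-spec p γ k N i)))

  modp-< : ∀ {p} (j : Fin p) m → modp p m < p
  modp-< {suc p} _ m = m%n<n m (suc p)

  sum-σpow : ∀ p γ k N → sum (σpow p γ k N) ≡ sum N
  sum-σpow p γ k N = begin
      sum (σpow p γ k N)                                               ≡⟨ sum-cong-≗ (σpow-as-sum p γ k N) ⟩
      sum (λ (i : Fin p) → sum (λ (j : Fin p) → summand i j))          ≡⟨ ∑-comm summand ⟩
      sum (λ (j : Fin p) → sum (λ (i : Fin p) → summand i j))          ≡⟨ sum-cong-≗ (λ j → sum-at (γᵏj j) (N j) (modp-< j _)) ⟩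
      sum N                                                            ∎
    where
    open ≡.≡-Reasoning
    γᵏj : Fin p → ℕ
    γᵏj j = modp p (γ ^ k ℕ.* toℕ j)
    summand : Fin p → Fin p → ℕ
    summand i j = χ (γᵏj j ℕ.≟ toℕ i) ℕ.* N j
    sum-at : ∀ m a → m < p → sum (λ (i : Fin p) → χ (m ℕ.≟ toℕ i) ℕ.* a) ≡ a
    sum-at m a m<p = ≡.trans (sum-supported-at _ (Fin.fromℕ< m<p) off)
                             (≡.trans (≡.cong (ℕ._* a) (χ-yes (m ℕ.≟ _) (≡.sym (FinP.toℕ-fromℕ< m<p)))) (ℕP.+-identityʳ a))
      where
      off : ∀ i → i ≢ Fin.fromℕ< m<p → χ (m ℕ.≟ toℕ i) ℕ.* a ≡ 0
      off i i≢m = ≡.cong (ℕ._* a) (χ-no (m ℕ.≟ toℕ i) λ m≡i →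
        i≢m (FinP.toℕ-injective (≡.trans (≡.sym m≡i) (≡.sym (FinP.toℕ-fromℕ< m<p)))))

  σpow-zero : ∀ p′ γ k N → Prime (suc p′) → 1 ≤ γ → γ < suc p′ → σpow (suc p′) γ k N zero ≡ N zero
  σpow-zero p′ γ k N p-prime 1≤γ γ<p =
    ≡.trans (σpow-as-sum p γ k N zero)
            (≡.trans (sum-supported-at _ zero off) (≡.trans (≡.cong (ℕ._* N zero) (χ-yes (_ ℕ.≟ 0) γᵏ0≡0)) (ℕP.+-identityʳ _)))
    where
    p : ℕ
    p = suc p′
    γᵏ0≡0 : modp p (γ ^ k ℕ.* 0) ≡ 0
    γᵏ0≡0 = ≡.cong (_% p) (ℕP.*-zeroʳ (γ ^ k))
    ∤γ^ : ∀ k → ¬ (p ∣ γ ^ k)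
    ∤γ^ zero    p∣1   = ℕP.<⇒≱ (ℕ.nonTrivial⇒n>1 p {{prime⇒nonTrivial p-prime}}) (∣⇒≤ p∣1)
    ∤γ^ (suc k) p∣γγᵏ with euclidsLemma γ (γ ^ k) p-prime p∣γγᵏ
    ... | inj₁ p∣γ  = ℕP.<⇒≱ γ<p (∣⇒≤ {{ℕ.>-nonZero 1≤γ}} p∣γ)
    ... | inj₂ p∣γᵏ = ∤γ^ k p∣γᵏ
    off : ∀ j → j ≢ zero → χ (modp p (γ ^ k ℕ.* toℕ j) ℕ.≟ 0) ℕ.* N j ≡ 0
    off zero    j≢0 = ⊥-elim (j≢0 ≡.refl)
    off (suc j) _   = ≡.cong (ℕ._* N (suc j)) (χ-no (_ ℕ.≟ 0) λ γᵏj≡0 → ∤γᵏj (m%n≡0⇒n∣m _ p γᵏj≡0))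
      where
      ∤γᵏj : ¬ (p ∣ γ ^ k ℕ.* suc (toℕ j))
      ∤γᵏj p∣γᵏj with euclidsLemma (γ ^ k) (suc (toℕ j)) p-prime p∣γᵏj
      ... | inj₁ p∣γᵏ = ∤γ^ k p∣γᵏ
      ... | inj₂ p∣j  = ℕP.<⇒≱ (FinP.toℕ<n (suc j)) (∣⇒≤ p∣j)

module CyclotomicEquality where

  open FinSum
  open import Data.Integer using (+_; -[1+_])
  import Data.Integer.Properties as ℤP

  ≗⇒CycEq : ∀ p {N M : Fin p → ℕ} → (∀ j → N j ≡ M j) → CycEq p N M
  ≗⇒CycEq p N≗M = + 0 , λ j → ≡.cong +_ (≡.trans (N≗M j) (≡.sym (ℕP.+-identityʳ _)))

  -- Two representatives of the same cyclotomic integer differ by c·(1,…,1), so equal coefficient sums force c = 0.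
  CycEq⇒≗ : ∀ {p} (N M : Fin p → ℕ) → 1 ≤ p → sum N ≡ sum M → CycEq p N M → ∀ j → N j ≡ M j
  CycEq⇒≗ {p} N M 1≤p ΣN≡ΣM (+ c , N≡M+c) j with ℕP.m*n≡0⇒m≡0∨n≡0 p (ℕP.+-cancelˡ-≡ (sum M) _ _ (begin
      sum M ℕ.+ p ℕ.* c                  ≡⟨ ≡.cong (sum M ℕ.+_) (≡.sym (sum-const p c)) ⟩
      sum M ℕ.+ sum {p} (λ _ → c)        ≡⟨ ≡.sym (∑-distrib-+ M (λ _ → c)) ⟩
      sum (λ i → M i ℕ.+ c)              ≡⟨ sum-cong-≗ (λ i → ≡.sym (ℤP.+-injective (N≡M+c i))) ⟩
      sum N                              ≡⟨ ΣN≡ΣM ⟩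
      sum M                              ≡⟨ ≡.sym (ℕP.+-identityʳ (sum M)) ⟩
      sum M ℕ.+ 0                        ∎))
    where open ≡.≡-Reasoning
  ... | inj₁ p≡0    = ⊥-elim (ℕP.<⇒≢ 1≤p (≡.sym p≡0))
  ... | inj₂ ≡.refl = ≡.trans (ℤP.+-injective (N≡M+c j)) (ℕP.+-identityʳ (M j))
  CycEq⇒≗ {p} N M 1≤p ΣN≡ΣM (-[1+ c ] , N≡M-c) j =
    ⊥-elim (ℕP.<⇒≢ (ℕP.*-mono-≤ 1≤p (s≤s z≤n)) (≡.sym (ℕP.+-cancelˡ-≡ (sum N) _ _ (begin
      sum N ℕ.+ p ℕ.* suc c              ≡⟨ ≡.cong (sum N ℕ.+_) (≡.sym (sum-const p (suc c))) ⟩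
      sum N ℕ.+ sum {p} (λ _ → suc c)    ≡⟨ ≡.sym (∑-distrib-+ N (λ _ → suc c)) ⟩
      sum (λ i → N i ℕ.+ suc c)          ≡⟨ sum-cong-≗ N+c≡M ⟩
      sum M                              ≡⟨ ≡.sym ΣN≡ΣM ⟩
      sum N                              ≡⟨ ≡.sym (ℕP.+-identityʳ (sum N)) ⟩
      sum N ℕ.+ 0                        ∎))))
    where
    open ≡.≡-Reasoning
    N+c≡M : ∀ i → N i ℕ.+ suc c ≡ M i
    N+c≡M i = ℤP.+-injective (begin
      + N i ℤ.+ + suc c                       ≡⟨ ≡.cong (ℤ._+ + suc c) (N≡M-c i) ⟩
      (+ M i ℤ.+ -[1+ c ]) ℤ.+ + suc c        ≡⟨ ℤP.+-assoc (+ M i) -[1+ c ] (+ suc c) ⟩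
      + M i ℤ.+ (-[1+ c ] ℤ.+ + suc c)        ≡⟨ ≡.cong (ℤ._+_ (+ M i)) (ℤP.+-inverseˡ (+ suc c)) ⟩
      + M i ℤ.+ + 0                           ≡⟨ ℤP.+-identityʳ (+ M i) ⟩
      + M i                                   ∎)

module WeilSum (K : FiniteField) (p n s : ℕ) where

  open FieldProperties K
  open FinSum

  f : Carrier → Carrier → Carrier
  f u x = pow K x s - u * x

  f-cong : ∀ {u v x y} → u ≈ v → x ≈ y → f u x ≈ f v y
  f-cong u≈v x≈y = +-cong (pow-cong s x≈y) (-‿cong (*-cong u≈v x≈y))

  W-as-sum : ∀ u j → W K p n s u j ≡ sum (λ i → χ (nat K (toℕ j) ≈? Tr K p n (f u (enum i))))
  W-as-sum u j = length-filter-tabulate (λ i → nat K (toℕ j) ≈? Tr K p n (f u (enum i))) id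

  W-cong : ∀ {u v} → u ≈ v → ∀ j → W K p n s u j ≡ W K p n s v j
  W-cong {u} {v} u≈v j = ≡.trans (W-as-sum u j) (≡.trans (sum-cong-≗ same-count) (≡.sym (W-as-sum v j)))
    where
    same-count : ∀ i → χ (nat K (toℕ j) ≈? Tr K p n (f u (enum i))) ≡ χ (nat K (toℕ j) ≈? Tr K p n (f v (enum i)))
    same-count i = χ-cong _ _ (λ e → trans e (Tr-cong p n (f-cong u≈v refl))) (λ e → trans e (Tr-cong p n (f-cong (sym u≈v) refl)))

module Counting (K : FiniteField) (p′ n s : ℕ) (p-prime : Prime (suc p′))
                (char-p : FiniteField._≈_ K (nat K (suc p′)) (FiniteField.0# K))
                (q≡p^n : FiniteField.q K ≡ suc p′ ^ n) (1≤s : 1 ≤ s) (s⊥q-1 : Coprime s (FiniteField.q K ∸ 1)) where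

  p : ℕ
  p = suc p′

  open FieldProperties K
  open Enumeration K
  open Fermat K using (power-map)
  open PrimeCharacteristic K p p-prime char-p
  open Trace K p n p-prime char-p q≡p^n
  open WeilSum K p n s
  open GaloisAction using (sum-σpow; σpow-zero)
  open CyclotomicEquality using (CycEq⇒≗)
  open FinSum

  χ₀ : Carrier → ℕ
  χ₀ y = χ (0# ≈? Tr K p n y)

  χ₀-cong : ∀ {x y} → x ≈ y → χ₀ x ≡ χ₀ y
  χ₀-cong x≈y = χ-cong _ _ (λ e → trans e (Tr-cong p n x≈y)) (λ e → trans e (Tr-cong p n (sym x≈y)))

  χ₀-0# : ∀ {y} → y ≈ 0# → χ₀ y ≡ 1
  χ₀-0# y≈0 = χ-yes (0# ≈? _) (sym (trans (Tr-cong p n y≈0) (Tr-0# n)))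

  W₀ : Carrier → ℕ
  W₀ u = W K p n s u zero

  #traceZeros : ℕ
  #traceZeros = sum (χ₀ ∘ enum)

  sum-W : ∀ u → sum (W K p n s u) ≡ q
  sum-W u = begin
      sum (W K p n s u)                                  ≡⟨ sum-cong-≗ (W-as-sum u) ⟩
      sum (λ j → sum (λ i → hit j (f u (enum i))))       ≡⟨ ∑-comm (λ j i → hit j (f u (enum i))) ⟩
      sum (λ i → sum (λ j → hit j (f u (enum i))))       ≡⟨ sum-cong-≗ (λ i → one-hit (f u (enum i))) ⟩
      sum {q} (λ _ → 1)                                  ≡⟨ sum-ones q ⟩
      q                                                  ∎
    where
    open ≡.≡-Reasoning
    hit : Fin p → Carrier → ℕ
    hit j y = χ (nat K (toℕ j) ≈? Tr K p n y)
    one-hit : ∀ y → sum (λ j → hit j y) ≡ 1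
    one-hit y with Tr-in-prime-field y
    ... | j₀ , Tr≈j₀ = ≡.trans (sum-supported-at _ j₀ miss) (χ-yes (nat K (toℕ j₀) ≈? _) (sym Tr≈j₀))
      where
      miss : ∀ j → j ≢ j₀ → hit j y ≡ 0
      miss j j≢j₀ = χ-no (nat K (toℕ j) ≈? _) λ j≈Tr →
        j≢j₀ (FinP.toℕ-injective (nat-injective (FinP.toℕ<n j) (FinP.toℕ<n j₀) (trans j≈Tr Tr≈j₀)))

  -- For x ≠ 0, u ↦ x^s − u x is a bijection of K.
  sum-over-u : ∀ x → x ≉ 0# → sum (λ j → χ₀ (f (enum j) x)) ≡ #traceZeros
  sum-over-u x x≉0 = ≡.sym (sum-reindex (setoidInverse (λ u → f u x) (λ v → (pow K x s - v) * inv x)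
      (λ u≈v → f-cong u≈v refl) (λ v≈w → *-congʳ (+-congˡ (-‿cong v≈w))) f-g g-f) ℕP.+-0-commutativeMonoid χ₀ χ₀-cong)
    where
    open ≈-Reasoning
    x⁻¹x-cancel : ∀ u → (u * x) * inv x ≈ u
    x⁻¹x-cancel u = trans (*-assoc _ _ _) (trans (*-congˡ (*-inverseʳ x≉0)) (*-identityʳ u))
    f-g : ∀ v → f ((pow K x s - v) * inv x) x ≈ v
    f-g v = begin
      pow K x s - ((pow K x s - v) * inv x) * x  ≈⟨ +-congˡ (-‿cong (trans (*-assoc _ _ _) (trans (*-congˡ (*-inverseˡ x≉0)) (*-identityʳ _)))) ⟩
      pow K x s - (pow K x s - v)                ≈⟨ solve 2 (λ a v → a :- (a :- v) := v) refl (pow K x s) v ⟩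
      v                                          ∎
    g-f : ∀ u → (pow K x s - f u x) * inv x ≈ u
    g-f u = trans (*-congʳ (solve 3 (λ a u x → a :- (a :- u :* x) := u :* x) refl (pow K x s) u x)) (x⁻¹x-cancel u)

  sum-over-u-at-0 : ∀ x → x ≈ 0# → sum (λ j → χ₀ (f (enum j) x)) ≡ q
  sum-over-u-at-0 x x≈0 = ≡.trans (sum-cong-≗ (λ j → χ₀-0# (f≈0 (enum j)))) (sum-ones q)
    where
    open ≈-Reasoning
    f≈0 : ∀ u → f u x ≈ 0#
    f≈0 u = begin
      pow K x s - u * x  ≈⟨ +-cong (trans (pow-cong s x≈0) (pow-0# 1≤s)) (-‿cong (trans (*-congˡ x≈0) (zeroʳ u))) ⟩
      0# - 0#            ≈⟨ -‿inverseʳ 0# ⟩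
      0#                 ∎

  sum-W₀ : sum (W₀ ∘ enum) ℕ.+ #traceZeros ≡ q ℕ.+ q ℕ.* #traceZeros
  sum-W₀ = begin
      sum (W₀ ∘ enum) ℕ.+ #traceZeros
        ≡⟨ ≡.cong (ℕ._+ #traceZeros) (sum-cong-≗ (λ j → W-as-sum (enum j) zero)) ⟩
      sum (λ j → sum (λ i → χ₀ (f (enum j) (enum i)))) ℕ.+ #traceZeros
        ≡⟨ ≡.cong (ℕ._+ #traceZeros) (∑-comm (λ j i → χ₀ (f (enum j) (enum i)))) ⟩
      sum (λ i → sum (λ j → χ₀ (f (enum j) (enum i)))) ℕ.+ #traceZeros
        ≡⟨ sum-constant-except _ (index 0#) q #traceZeros (sum-over-u-at-0 (enum (index 0#)) (enum-index 0#))
                                                         (λ i i≢0 → sum-over-u (enum i) (enum-≉ i≢0)) ⟩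
      q ℕ.+ q ℕ.* #traceZeros
        ∎
    where open ≡.≡-Reasoning

  W₀-0# : ∀ u → u ≈ 0# → W₀ u ≡ #traceZeros
  W₀-0# u u≈0 = ≡.trans (W-as-sum u zero) (≡.trans (sum-cong-≗ (λ i → χ₀-cong (f-0 (enum i))))
                 (≡.sym (sum-reindex (power-map s 1≤s s⊥q-1) ℕP.+-0-commutativeMonoid χ₀ χ₀-cong)))
    where
    f-0 : ∀ x → f u x ≈ pow K x s
    f-0 x = trans (+-congˡ (-‿cong (trans (*-congʳ u≈0) (zeroˡ x)))) (trans (+-congˡ -0#≈0#) (+-identityʳ _))

  1≤#traceZeros : 1 ≤ #traceZeros
  1≤#traceZeros = ℕP.≤-trans (ℕP.≤-reflexive (≡.sym (χ₀-0# (enum-index 0#)))) (≤-sum (χ₀ ∘ enum) (index 0#))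

  #traceZeros≤q : #traceZeros ≤ q
  #traceZeros≤q = ℕP.≤-trans (sum-mono {q} {f = χ₀ ∘ enum} {g = λ _ → 1} (λ i → χ≤1 (0# ≈? _))) (ℕP.≤-reflexive (sum-ones q))

  #traceZeros≢q : #traceZeros ≢ q
  #traceZeros≢q T≡q = Tr-not-identically-zero (λ i → sym (χ≡1⇒ (0# ≈? _) (sum≡n⇒≡1 (χ₀ ∘ enum) (λ i → χ≤1 (0# ≈? _)) T≡q i)))

  -- A trace with trivial kernel is an injection of K into the prime field.
  #traceZeros≡1⇒q≤p : #traceZeros ≡ 1 → q ≤ p
  #traceZeros≡1⇒q≤p T≡1 = FinP.injective⇒≤ {f = toPrimeField} toPrimeField-injective
    where
    open ≈-Reasoning
    kernel-trivial : ∀ y → Tr K p n y ≈ 0# → y ≈ 0#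
    kernel-trivial y Tr≈0 with index y Fin.≟ index 0#
    ... | yes eq = index-injective eq
    ... | no ne  = ⊥-elim (ℕP.<-irrefl (≡.sym T≡1) (2≤sum (χ₀ ∘ enum) (index 0#) (index y) (ne ∘ ≡.sym) (χ₀-0# (enum-index 0#))
                     (χ-yes (0# ≈? _) (sym (trans (Tr-cong p n (enum-index y)) Tr≈0)))))
    toPrimeField : Fin q → Fin p
    toPrimeField i = proj₁ (Tr-in-prime-field (enum i))
    toPrimeField-injective : ∀ {i j} → toPrimeField i ≡ toPrimeField j → i ≡ j
    toPrimeField-injective {i} {j} eq = enum-inj i j (x-y≈0⇒x≈y (kernel-trivial _ (begin
      Tr K p n (enum i - enum j)                        ≈⟨ Tr-minus n (enum i) (enum j) ⟩
      Tr K p n (enum i) - Tr K p n (enum j)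
        ≈⟨ +-congʳ (trans (proj₂ (Tr-in-prime-field (enum i))) (reflexive (≡.cong (nat K ∘ toℕ) eq))) ⟩
      nat K (toℕ (toPrimeField j)) - Tr K p n (enum j)  ≈⟨ +-congʳ (sym (proj₂ (Tr-in-prime-field (enum j)))) ⟩
      Tr K p n (enum j) - Tr K p n (enum j)             ≈⟨ -‿inverseʳ _ ⟩
      0#                                                ∎)))

  q≤p⇒q≡p : q ≤ p → q ≡ p
  q≤p⇒q≡p = power≤p⇒≡p n q≡p^n
    where
    power≤p⇒≡p : ∀ k → q ≡ p ^ k → q ≤ p → q ≡ p
    power≤p⇒≡p zero    q≡1     _   = ⊥-elim (ℕP.<-irrefl (≡.sym q≡1) 2≤q)
    power≤p⇒≡p (suc m) q≡p*p^m q≤p =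
      ℕP.≤-antisym q≤p (ℕP.≤-trans (ℕP.m≤m*n p (p ^ m) {{ℕ.>-nonZero (ℕP.m^n>0 p m)}}) (ℕP.≤-reflexive (≡.sym q≡p*p^m)))

  -- A trivial trace kernel forces q = p; for odd p the exponent s is odd, so 0, 1 and −1 all solve x^s = x.
  trivial-kernel⇒3≤W₀-1# : #traceZeros ≡ 1 → q ≢ 2 → 3 ≤ W₀ 1#
  trivial-kernel⇒3≤W₀-1# T≡1 q≢2 = ≡.subst (3 ≤_) (≡.sym (W-as-sum 1# zero))
    (3≤sum _ (index 0#) (index 1#) (index (- 1#)) (index-≢ (λ e → 1≉0 (sym e))) (index-≢ (λ e → -1≉0 (sym e))) (index-≢ (1≉-1 3≤p))
           (fixed⇒χ₀ (pow-0# 1≤s)) (fixed⇒χ₀ (pow-1# s)) (fixed⇒χ₀ [-1]^s≈-1))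
    where
    open ≈-Reasoning
    open import Data.Nat using (_/_)
    open import Data.Nat.Divisibility using (_∣_; divides)
    open import Data.Nat.Primality using (prime⇒irreducible)
    q≡p : q ≡ p
    q≡p = q≤p⇒q≡p (#traceZeros≡1⇒q≤p T≡1)
    p≢2 : p ≢ 2
    p≢2 p≡2 = q≢2 (≡.trans q≡p p≡2)
    3≤p : 3 ≤ p
    3≤p = ℕP.≤∧≢⇒< 2≤p (p≢2 ∘ ≡.sym)
    p-odd : p ≡ 1 ℕ.+ (p / 2) ℕ.* 2
    p-odd = Arithmetic.¬2∣⇒odd p λ 2∣p → [ (λ ()) , p≢2 ∘ ≡.sym ]′ (prime⇒irreducible p-prime 2∣p)
    2∣q-1 : 2 ∣ q ∸ 1
    2∣q-1 = divides (p / 2) (≡.cong (_∸ 1) (≡.trans q≡p p-odd))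
    s-odd : s ≡ 1 ℕ.+ (s / 2) ℕ.* 2
    s-odd = Arithmetic.¬2∣⇒odd s λ 2∣s → case s⊥q-1 (2∣s , 2∣q-1) of λ ()
    [-1]^s≈-1 : pow K (- 1#) s ≈ - 1#
    [-1]^s≈-1 = ≡.subst (λ e → pow K (- 1#) e ≈ - 1#) (≡.sym s-odd) (pow-[-1]-odd (s / 2))
    index-≢ : ∀ {x y} → x ≉ y → index x ≢ index y
    index-≢ x≉y = x≉y ∘ index-injective
    fixed⇒χ₀ : ∀ {x} → pow K x s ≈ x → χ₀ (f 1# (enum (index x))) ≡ 1
    fixed⇒χ₀ {x} x^s≈x = χ₀-0# (begin
      f 1# (enum (index x))  ≈⟨ f-cong refl (enum-index x) ⟩
      pow K x s - 1# * x     ≈⟨ +-cong x^s≈x (-‿cong (*-identityˡ x)) ⟩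
      x - x                  ≈⟨ -‿inverseʳ x ⟩
      0#                     ∎)

  module _ (γ : ℕ) (1≤γ : 1 ≤ γ) (γ<p : γ < p) (single-cycle : SingleCycle K p n s γ) where

    u₀ : Carrier
    u₀ = proj₁ (proj₁ single-cycle)

    -- σ^k fixes the coefficient of ζ⁰ and every W_u has coefficient sum q.
    W₀-constant : ∀ u → u ≉ 0# → W₀ u ≡ W₀ u₀
    W₀-constant u u≉0 with proj₂ single-cycle (u , u≉0)
    ... | k , σᵏW≈W = ≡.trans (≡.sym (CycEq⇒≗ (σpow p γ k (W K p n s u₀)) (W K p n s u) (s≤s z≤n) same-sum σᵏW≈W zero))
                              (σpow-zero p′ γ k (W K p n s u₀) p-prime 1≤γ γ<p)
      where
      same-sum : sum (σpow p γ k (W K p n s u₀)) ≡ sum (W K p n s u)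
      same-sum = ≡.trans (sum-σpow p γ k (W K p n s u₀)) (≡.trans (sum-W u₀) (≡.sym (sum-W u)))

    W₀-sum-constant : sum (W₀ ∘ enum) ℕ.+ W₀ u₀ ≡ #traceZeros ℕ.+ q ℕ.* W₀ u₀
    W₀-sum-constant = sum-constant-except (W₀ ∘ enum) (index 0#) #traceZeros (W₀ u₀) (W₀-0# _ (enum-index 0#))
      (λ i i≢0 → W₀-constant (enum i) (enum-≉ i≢0))

    count-solutions : #traceZeros ≡ suc (q ∸ 1) ⊎ (#traceZeros ≡ 1 × W₀ u₀ ≡ 2)
    count-solutions = Arithmetic.count-equation-solutions (q ∸ 1) (W₀ u₀) #traceZeros
      (ℕP.∸-monoˡ-≤ 1 2≤q) 1≤#traceZeros (≡.subst (#traceZeros ≤_) q≡1+[q-1] #traceZeros≤q)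
      (Arithmetic.eliminate-total (q ∸ 1) (W₀ u₀) #traceZeros (sum (W₀ ∘ enum))
        (≡.subst (λ r → sum (W₀ ∘ enum) ℕ.+ W₀ u₀ ≡ #traceZeros ℕ.+ r ℕ.* W₀ u₀) q≡1+[q-1] W₀-sum-constant)
        (≡.subst (λ r → sum (W₀ ∘ enum) ℕ.+ #traceZeros ≡ r ℕ.+ r ℕ.* #traceZeros) q≡1+[q-1] sum-W₀))

    single-cycle⇒q≡2 : q ≡ 2
    single-cycle⇒q≡2 = decidable-stable (q ℕ.≟ 2) λ q≢2 → [ T≢q , kernel-case q≢2 ]′ count-solutions
      where
      T≢q : #traceZeros ≢ suc (q ∸ 1)
      T≢q T≡q = #traceZeros≢q (≡.trans T≡q (≡.sym q≡1+[q-1]))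
      kernel-case : q ≢ 2 → ¬ (#traceZeros ≡ 1 × W₀ u₀ ≡ 2)
      kernel-case q≢2 (T≡1 , C≡2) = ℕP.<⇒≢ (trivial-kernel⇒3≤W₀-1# T≡1 q≢2) (≡.sym (≡.trans (W₀-constant 1# 1≉0) C≡2))

single-cycle⇒q≡2 : ∀ (K : FiniteField) p n s γ → Prime p → FiniteField._≈_ K (nat K p) (FiniteField.0# K) →
                   FiniteField.q K ≡ p ^ n → 1 ≤ s → Coprime s (FiniteField.q K ∸ 1) → IsGenerator p γ →
                   SingleCycle K p n s γ → FiniteField.q K ≡ 2
single-cycle⇒q≡2 K zero     n s γ p-prime = ⊥-elim (ℕP.<⇒≱ (ℕ.nonTrivial⇒n>1 0 {{prime⇒nonTrivial p-prime}}) z≤n)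
single-cycle⇒q≡2 K (suc p′) n s γ p-prime char-p q≡p^n 1≤s s⊥q-1 (1≤γ , γ<p , _) =
  Counting.single-cycle⇒q≡2 K p′ n s p-prime char-p q≡p^n 1≤s s⊥q-1 γ 1≤γ γ<p

module TwoElementField (K : FiniteField) (q≡2 : FiniteField.q K ≡ 2) (n s : ℕ) where

  open FieldProperties K
  open Enumeration K
  open CyclotomicEquality using (≗⇒CycEq)

  unit≈1# : ∀ u → u ≉ 0# → u ≈ 1#
  unit≈1# u u≉0 =
    index-injective (third q≡2 (index 0#) (index 1#) (index u) (λ e → 1≉0 (sym (index-injective e))) (u≉0 ∘ index-injective))
    where
    third : ∀ {m} → m ≡ 2 → (a b c : Fin m) → a ≢ b → c ≢ a → c ≡ b
    third ≡.refl zero       zero       _          a≢b _   = ⊥-elim (a≢b ≡.refl)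
    third ≡.refl (suc zero) (suc zero) _          a≢b _   = ⊥-elim (a≢b ≡.refl)
    third ≡.refl zero       (suc zero) zero       _   c≢a = ⊥-elim (c≢a ≡.refl)
    third ≡.refl zero       (suc zero) (suc zero) _   _   = ≡.refl
    third ≡.refl (suc zero) zero       zero       _   _   = ≡.refl
    third ≡.refl (suc zero) zero       (suc zero) _   c≢a = ⊥-elim (c≢a ≡.refl)

  W-units-equal : ∀ (u v : Units K 2 n s 1) → ∀ j → Wu K 2 n s 1 u j ≡ Wu K 2 n s 1 v j
  W-units-equal (u , u≉0) (v , v≉0) = WeilSum.W-cong K 2 n s (trans (unit≈1# u u≉0) (sym (unit≈1# v v≉0)))

  σpow-trivial : ∀ k → k ≤ 1 → ∀ N i → σpow 2 1 k N i ≡ N i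
  σpow-trivial zero       _ N zero       = ℕP.+-identityʳ (N zero)
  σpow-trivial zero       _ N (suc zero) = ℕP.+-identityʳ (N (suc zero))
  σpow-trivial (suc zero) _ N zero       = ℕP.+-identityʳ (N zero)
  σpow-trivial (suc zero) _ N (suc zero) = ℕP.+-identityʳ (N (suc zero))
  σpow-trivial (suc (suc k)) (s≤s ()) N i

  single-cycle : SingleCycle K 2 n s 1
  single-cycle = (1# , 1≉0) , λ u → 0 , ≗⇒CycEq 2 (λ j → ≡.trans (σpow-trivial 0 z≤n _ j) (W-units-equal (1# , 1≉0) u j))

  one-cycle : OneCycle K 2 n s 1
  one-cycle = (λ u v → ≗⇒CycEq 2 (W-units-equal u v)) , (λ u → ≗⇒CycEq 2 (σpow-trivial 1 ℕP.≤-refl _))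

  degenerate : ∀ p → Degenerate p (FiniteField.q K) s
  degenerate p rewrite q≡2 = 0 , n%1≡0 s
    where open import Data.Nat.DivMod using (n%1≡0)

prime-power≡2⇒≡2 : ∀ p n → Prime p → 2 ≡ p ^ n → p ≡ 2
prime-power≡2⇒≡2 p zero    _       ()
prime-power≡2⇒≡2 p (suc m) p-prime 2≡p*p^m =
  ℕP.≤-antisym (∣⇒≤ (divides (p ^ m) (≡.trans 2≡p*p^m (ℕP.*-comm p (p ^ m)))))
               (ℕ.nonTrivial⇒n>1 p {{prime⇒nonTrivial p-prime}})

generator-of-𝔽₂ : ∀ γ → IsGenerator 2 γ → γ ≡ 1
generator-of-𝔽₂ γ (1≤γ , γ<2 , _) = ℕP.≤-antisym (ℕP.≤-pred γ<2) 1≤γ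

proposition2p5 : (K : FiniteField) (p n s γ : ℕ)
    → Prime p
    → FiniteField._≈_ K (nat K p) (FiniteField.0# K)
    → FiniteField.q K ≡ p ^ n
    → 1 ≤ s
    → Coprime s (FiniteField.q K ∸ 1)
    → IsGenerator p γ
    → (SingleCycle K p n s γ ⇔ FiniteField.q K ≡ 2)
      × (FiniteField.q K ≡ 2 → Degenerate p (FiniteField.q K) s × OneCycle K p n s γ)
proposition2p5 K p n s γ p-prime char-p q≡p^n 1≤s s⊥q-1 γ-generator =
  mk⇔ (single-cycle⇒q≡2 K p n s γ p-prime char-p q≡p^n 1≤s s⊥q-1 γ-generator) (λ q≡2 → 𝔽₂-case q≡2 .proj₁) ,
  λ q≡2 → TwoElementField.degenerate K q≡2 n s p , 𝔽₂-case q≡2 .proj₂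
  where
  𝔽₂-case : FiniteField.q K ≡ 2 → SingleCycle K p n s γ × OneCycle K p n s γ
  𝔽₂-case q≡2 = ≡.subst₂ (λ p γ → SingleCycle K p n s γ × OneCycle K p n s γ) (≡.sym p≡2) (≡.sym γ≡1)
                  (TwoElementField.single-cycle K q≡2 n s , TwoElementField.one-cycle K q≡2 n s)
    where
    p≡2 : p ≡ 2
    p≡2 = prime-power≡2⇒≡2 p n p-prime (≡.trans (≡.sym q≡2) q≡p^n)
    γ≡1 : γ ≡ 1
    γ≡1 = generator-of-𝔽₂ γ (≡.subst (λ p → IsGenerator p γ) p≡2 γ-generator)
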